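{- Let $g:\mathbb{N}\to\mathbb{C}$ be a totally multiplicative arithmetic function, i.e. $g(rs)=g(r)g(s)$ for all positive integers $r,s$, and for real $x$ put $M(g,x)=\sum_{1\le n\le x}\mu(n)g(n)$, where $\mu$ is the M\"obius function. Let $d\ge 2$ be an integer, let $N_1,\ldots,N_d$ be positive integers, and let $K$ be a positive integer with $K<(1+N_1)(1+N_2)\cdots(1+N_d)$. For a word $V=v_1v_2\cdots v_d\in\{0,1\}^d$ let $w(V)=v_1+\cdots+v_d$ be its weight, and let $\sum_1^1(V)$ denote summation over integers $n_1,\ldots,n_d$ where $n_i=1$ (fixed) if $v_i=0$, and $n_i$ runs over $1,2,\ldots,N_i$ if $v_i=1$. Then $$ M(g,K)=\sum_{i=1}^d M\bigl(g,\min\{N_i,K\}\bigr)\;-\;\sum_{V\in\{0,1\}^d\,:\,w(V)\ge 2}(-1)^{w(V)}\sum_1^1(V)\;\sum_{\substack{k_1,\ldots,k_{w(V)-1}\ge 1\\ k_1k_2\cdots k_{w(V)-1}\le K/(n_1n_2\cdots n_d)}} g\bigl(k_1\cdots k_{w(V)-1}\bigr)\prod_{i=1}^d\mu(n_i)g(n_i), $$ where the innermost sum is over all $(w(V)-1)$-tuples of positive integers $k_1,\ldots,k_{w(V)-1}$ whose product is at most $K/(n_1n_2\cdots n_d)$.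
   Context: $\mu$ denotes the number-theoretic M\"obius function: $\mu(n)=(-1)^\nu$ if $n$ is a product of $\nu$ distinct primes, and $\mu(n)=0$ if $n$ has a repeated prime factor; $\mu(1)=1$. -}

module Defs where

open import Level using (Level)
open import Function using (_∘_)
open import Algebra.Bundles using (CommutativeRing)
open import Data.Nat as ℕ using (ℕ; zero; suc; _≤?_)
open import Data.Nat.Divisibility using (_∣?_)
open import Data.Nat.Primality using (prime?)
open import Data.Integer as ℤ using (ℤ; +_; -[1+_])
open import Data.Bool using (Bool; true; false; if_then_else_)
open import Data.Fin using (Fin; zero; suc)
open import Data.List using (List; []; _∷_; map; filter; length; upTo; foldr; concatMap; null; allFin)
open import Relation.Nullary.Decidable using (⌊_⌋; _×-dec_)

-- Möbius function (as in the paper): μ(n) = (-1)^ν if n is squarefree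
-- with ν distinct prime factors, 0 if some p² ∣ n.  (μ 1 = 1; μ 0 = 0,
-- never used.)  Prime divisors of n are all ≤ n, so searching 0..n suffices.

primeDivisors : ℕ → List ℕ
primeDivisors n = filter (λ p → prime? p ×-dec (p ∣? n)) (upTo (suc n))

squarefree : ℕ → Bool
squarefree n = null (filter (λ p → prime? p ×-dec ((p ℕ.* p) ∣? n)) (upTo (suc n)))

μ : ℕ → ℤ
μ n = if squarefree n then (ℤ.- (+ 1)) ℤ.^ length (primeDivisors n) else + 0

range1 : ℕ → List ℕ
range1 n = map suc (upTo n)

cons : ∀ {a} {A : Set a} {m : ℕ} → A → (Fin m → A) → Fin (suc m) → A
cons x t zero = x
cons x t (suc i) = t i

tuples : ∀ {a} {A : Set a} (m : ℕ) → (Fin m → List A) → List (Fin m → A)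
tuples zero R = (λ ()) ∷ []
tuples (suc m) R = concatMap (λ x → map (cons x) (tuples m (R ∘ suc))) (R zero)

-- all words V ∈ {0,1}^d  (true = 1, false = 0)
words : (d : ℕ) → List (Fin d → Bool)
words d = tuples d (λ _ → false ∷ true ∷ [])

prodℕ : (m : ℕ) → (Fin m → ℕ) → ℕ
prodℕ zero t = 1
prodℕ (suc m) t = t zero ℕ.* prodℕ m (t ∘ suc)

sumℕ : (m : ℕ) → (Fin m → ℕ) → ℕ
sumℕ zero t = 0
sumℕ (suc m) t = t zero ℕ.+ sumℕ m (t ∘ suc)

weight : (d : ℕ) → (Fin d → Bool) → ℕ
weight d V = sumℕ d (λ i → if V i then 1 else 0)

-- Ring-valued notions, for a commutative ring R (standing in for ℂ)

module _ {c ℓ : Level} (R : CommutativeRing c ℓ) where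
  open CommutativeRing R using (Carrier; _≈_; _+_; _*_; -_; 0#; 1#)

  sumR : List Carrier → Carrier
  sumR = foldr _+_ 0#

  prodR : (m : ℕ) → (Fin m → Carrier) → Carrier
  prodR zero t = 1#
  prodR (suc m) t = t zero * prodR m (t ∘ suc)

  natR : ℕ → Carrier
  natR zero = 0#
  natR (suc n) = 1# + natR n

  intR : ℤ → Carrier
  intR (+ n) = natR n
  intR (-[1+ n ]) = - natR (suc n)

  signR : ℕ → Carrier
  signR zero = 1#
  signR (suc k) = - signR k

  TotallyMultiplicative : (ℕ → Carrier) → Set ℓ
  TotallyMultiplicative g = ∀ r s → 1 ℕ.≤ r → 1 ℕ.≤ s → g (r ℕ.* s) ≈ g r * g s

  M : (ℕ → Carrier) → ℕ → Carrier
  M g x = sumR (map (λ n → intR (μ n) * g n) (range1 x))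

  -- Σ over (m)-tuples k of positive integers with k₁⋯k_m ≤ K/P, i.e.
  -- (k₁⋯k_m)·P ≤ K, of g(k₁⋯k_m).  Each k_i ≤ K necessarily (P ≥ 1), so
  -- enumerating k_i ∈ [1..K] loses nothing.
  innerSum : (ℕ → Carrier) → (m K P : ℕ) → Carrier
  innerSum g m K P =
    sumR (map (λ k → if ⌊ prodℕ m k ℕ.* P ≤? K ⌋ then g (prodℕ m k) else 0#)
              (tuples m (λ _ → range1 K)))

  wordTerm : (ℕ → Carrier) → (d : ℕ) → (N : Fin d → ℕ) → (K : ℕ) → (Fin d → Bool) → Carrier
  wordTerm g d N K V =
    sumR (map (λ n → innerSum g (weight d V ℕ.∸ 1) K (prodℕ d n)
                       * prodR d (λ i → intR (μ (n i)) * g (n i)))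
              (tuples d (λ i → if V i then range1 (N i) else (1 ∷ []))))

  bigSum : (ℕ → Carrier) → (d : ℕ) → (N : Fin d → ℕ) → (K : ℕ) → Carrier
  bigSum g d N K =
    sumR (map (λ V → signR (weight d V) * wordTerm g d N K V)
              (filter (λ V → 2 ≤? weight d V) (words d)))

  firstSum : (ℕ → Carrier) → (d : ℕ) → (N : Fin d → ℕ) → (K : ℕ) → Carrier
  firstSum g d N K = sumR (map (λ i → M g (N i ℕ.⊓ K)) (allFin d))

-- Work in the ring of arithmetic functions under Dirichlet convolution ⋆, with ν = μ mapped
-- into R, 𝟙 the indicator of [1, K] and νᵢ the restriction of ν to [1, Nᵢ]. Möbius inversion
-- gives ν ⋆ 𝟙 = δ on [1, K], so cᵢ = 𝟙 ⋆ νᵢ agrees with δ on [1, min(Nᵢ, K)]; hence the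
-- product ∏ᵢ (δ - cᵢ), and with it ν ⋆ ∏ᵢ (δ - cᵢ), vanishes on [1, K] since K < ∏ᵢ (1 + Nᵢ).
-- Expanding the product over the words V ∈ {0,1}^d and cancelling ν ⋆ 𝟙, words of weight 0
-- and 1 contribute ν - Σᵢ νᵢ, and a word of weight w ≥ 2 contributes (-1)^w 𝟙^(w-1) ⋆ ∏_{vᵢ=1} νᵢ,
-- whose value at m counts exactly the tuples (k, n) of the paper's inner sums with
-- k₁⋯k_{w-1}·n₁⋯n_d = m. This expresses μ(m) for m ≤ K; multiplying by g(m) and summing,
-- total multiplicativity turns g(k₁⋯k_{w-1}) ∏ g(nᵢ) into g(m).

module Submission where

open import Defs
open import Level using (Level)
open import Algebra.Bundles using (CommutativeRing)
open import Data.Nat as ℕ using (ℕ; zero; suc; _≤_; _<_; _≟_; _≤?_; _⊓_; z≤n; s≤s)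
import Data.Nat.Properties as ℕₚ
open import Data.Nat.Divisibility
  using (_∣_; _∣?_; divides; ∣⇒≤; ∣m∣n⇒∣m+n; ∣m+n∣m⇒∣n; m∣m*n; ∣n⇒∣m*n; *-cancelˡ-∣; *-monoʳ-∣; ∣-refl)
open import Data.Nat.Primality using (Prime; prime⇒nonZero)
open import Data.Nat.Primality.Factorisation using (factorise)
open import Data.Nat.Coprimality using (coprime-divisor)
import Data.Integer as ℤ
open import Data.Fin using (Fin) renaming (zero to fzero; suc to fsuc)
open import Function using (_∘_)
open import Data.Bool using (Bool; true; false; not; if_then_else_)
open import Data.List using (List; []; _∷_; map; filter; upTo; _++_; concatMap; [_]; allFin)
open import Data.List.Properties using (upTo-∷ʳ; map-++; map-tabulate)
open import Data.List.Membership.Propositional using (_∈_; find)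
open import Data.List.Membership.Propositional.Properties using (∈-map⁻; ∈-concatMap⁻; ∈-filter⁻)
open import Data.List.Relation.Unary.Any using (here; there)
open import Data.List.Relation.Unary.All using (_∷_)
open import Relation.Nullary using (Dec; yes; no; ¬_)
open import Relation.Nullary.Decidable using (⌊_⌋)
open import Relation.Binary.PropositionalEquality as ≡ using (_≡_)
open import Data.Empty using (⊥-elim)
open import Data.Product using (_,_; ∃; _×_; proj₂)
import Algebra.Properties.CommutativeSemigroup as CommutativeSemigroupProperties

module MöbiusRecurrence where

  open import Data.Nat using (_*_; _+_; _<?_)
  open import Data.Nat.Properties
  open import Data.Nat.Divisibility
  open import Data.Nat.Primality
  open import Data.Nat.Coprimality using (Coprime)
  open import Data.Integer.Properties using (-1*i≡-i)
  open import Data.List using (length; null)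
  open import Data.List.Properties using (filter-++; length-++)
  open import Data.List.Membership.Propositional.Properties using (∈-upTo⁺; ∈-filter⁺)
  open import Relation.Nullary.Decidable using (_×-dec_)
  open import Relation.Binary.PropositionalEquality using (_≢_; refl; sym; trans; cong; cong₂; module ≡-Reasoning)
  open import Data.Sum using (inj₁; inj₂)

  private
    variable
      A B : Set

  ¬null-filter⇒∃ : ∀ {P : A → Set} (P? : ∀ x → Dec (P x)) xs →
    null (filter P? xs) ≡ false → ∃ λ x → x ∈ xs × P x
  ¬null-filter⇒∃ P? (x ∷ xs) e with P? x
  ... | yes px = x , here refl , px
  ... | no _ with ¬null-filter⇒∃ P? xs e
  ...   | y , y∈ , py = y , there y∈ , py

  ∃⇒¬null-filter : ∀ {P : A → Set} (P? : ∀ x → Dec (P x)) {x} xs →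
    x ∈ xs → P x → null (filter P? xs) ≡ false
  ∃⇒¬null-filter P? xs x∈ px with filter P? xs | ∈-filter⁺ P? x∈ px
  ... | _ ∷ _ | _ = refl

  ⌊⌋-⇔ : (A → B) → (B → A) → (a? : Dec A) (b? : Dec B) → ⌊ a? ⌋ ≡ ⌊ b? ⌋
  ⌊⌋-⇔ f g (yes _) (yes _) = refl
  ⌊⌋-⇔ f g (no _) (no _) = refl
  ⌊⌋-⇔ f g (yes a) (no ¬b) = ⊥-elim (¬b (f a))
  ⌊⌋-⇔ f g (no ¬a) (yes b) = ⊥-elim (¬a (g b))

  prime⇒1≤ : ∀ {p} → Prime p → 1 ≤ p
  prime⇒1≤ {p} pr = <⇒≤ (ℕ.nonTrivial⇒n>1 p {{prime⇒nonTrivial pr}})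

  prime∣prime⇒≡ : ∀ {p q} → Prime p → Prime q → q ∣ p → q ≡ p
  prime∣prime⇒≡ pp pq q∣p with prime⇒irreducible pp q∣p
  ... | inj₁ refl = ⊥-elim (<-irrefl refl (ℕ.nonTrivial⇒n>1 1 {{prime⇒nonTrivial pq}}))
  ... | inj₂ q≡p = q≡p

  coprime-prime : ∀ {p a} → Prime p → ¬ p ∣ a → Coprime a p
  coprime-prime pp p∤a (i∣a , i∣p) with prime⇒irreducible pp i∣p
  ... | inj₁ i≡1 = i≡1
  ... | inj₂ refl = ⊥-elim (p∤a i∣a)

  square∣p*a⇒square∣a : ∀ {p q a} → Prime p → Prime q → ¬ p ∣ a → q * q ∣ p * a → q * q ∣ a
  square∣p*a⇒square∣a {p} {q} pp pq p∤a h with q ≟ p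
  ... | yes refl = ⊥-elim (p∤a (*-cancelˡ-∣ p {{prime⇒nonZero pp}} h))
  ... | no q≢p = coprime-divisor (coprime-prime pp p∤q²) h
    where
    p∤q² : ¬ p ∣ q * q
    p∤q² p∣q² with euclidsLemma q q pp p∣q²
    ... | inj₁ p∣q = q≢p (sym (prime∣prime⇒≡ pq pp p∣q))
    ... | inj₂ p∣q = q≢p (sym (prime∣prime⇒≡ pq pp p∣q))

  squarefree≡false : ∀ {n q} → 1 ≤ n → Prime q → q * q ∣ n → squarefree n ≡ false
  squarefree≡false {suc n} {q} _ pq h =
    ∃⇒¬null-filter (λ p → prime? p ×-dec ((p * p) ∣? suc n)) (upTo (suc (suc n)))
      (∈-upTo⁺ (s≤s (∣⇒≤ (m*n∣⇒m∣ q q h)))) (pq , h)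

  squarefree≡false⇒square∣ : ∀ {n} → squarefree n ≡ false → ∃ λ q → Prime q × q * q ∣ n
  squarefree≡false⇒square∣ {n} e with ¬null-filter⇒∃ (λ p → prime? p ×-dec ((p * p) ∣? n)) (upTo (suc n)) e
  ... | q , _ , pq , h = q , pq , h

  squarefree-p* : ∀ {p a} → 1 ≤ a → Prime p → ¬ p ∣ a → squarefree (p * a) ≡ squarefree a
  squarefree-p* {p} {a} 1≤a pp p∤a with squarefree a in sqf[a] | squarefree (p * a) in sqf[pa]
  ... | true | true = refl
  ... | false | false = refl
  ... | false | true with squarefree≡false⇒square∣ sqf[a]
  ...   | q , pq , q²∣a with trans (sym sqf[pa]) (squarefree≡false (*-mono-≤ (prime⇒1≤ pp) 1≤a) pq (∣n⇒∣m*n p q²∣a))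
  ...     | ()
  squarefree-p* {p} {a} 1≤a pp p∤a | true | false with squarefree≡false⇒square∣ sqf[pa]
  ...   | q , pq , q²∣pa with trans (sym sqf[a]) (squarefree≡false 1≤a pq (square∣p*a⇒square∣a pp pq p∤a q²∣pa))
  ...     | ()

  μ-p*-square : ∀ {p a} → 1 ≤ a → Prime p → p ∣ a → μ (p * a) ≡ ℤ.0ℤ
  μ-p*-square {p} {a} 1≤a pp p∣a
    rewrite squarefree≡false {p * a} (*-mono-≤ (prime⇒1≤ pp) 1≤a) pp (*-monoʳ-∣ p p∣a) = refl

  PrimeDivisor : ℕ → ℕ → Set
  PrimeDivisor n q = Prime q × q ∣ n

  primeDivisor? : ∀ n q → Dec (PrimeDivisor n q)
  primeDivisor? n q = prime? q ×-dec q ∣? n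

  -- primeDivisors n unfolds to #primeDivisors< (suc n) n.
  #primeDivisors< : ℕ → ℕ → ℕ
  #primeDivisors< L n = length (filter (primeDivisor? n) (upTo L))

  indicator : Bool → ℕ
  indicator b = if b then 1 else 0

  indicator-no : ∀ (a? : Dec A) → ¬ A → indicator ⌊ a? ⌋ ≡ 0
  indicator-no (yes a) ¬a = ⊥-elim (¬a a)
  indicator-no (no _) _ = refl

  indicator-yes : ∀ (a? : Dec A) → A → indicator ⌊ a? ⌋ ≡ 1
  indicator-yes (yes _) _ = refl
  indicator-yes (no ¬a) a = ⊥-elim (¬a a)

  #primeDivisors<-suc : ∀ L n → #primeDivisors< (suc L) n ≡ #primeDivisors< L n + indicator ⌊ primeDivisor? n L ⌋
  #primeDivisors<-suc L n = begin
    length (filter P? (upTo (suc L)))            ≡⟨ cong (length ∘ filter P?) (sym (upTo-∷ʳ L)) ⟩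
    length (filter P? (upTo L ++ [ L ]))         ≡⟨ cong length (filter-++ P? (upTo L) [ L ]) ⟩
    length (filter P? (upTo L) ++ filter P? [ L ]) ≡⟨ length-++ (filter P? (upTo L)) ⟩
    #primeDivisors< L n + length (filter P? [ L ]) ≡⟨ cong (#primeDivisors< L n +_) (length-filter-[L]) ⟩
    #primeDivisors< L n + indicator ⌊ P? L ⌋      ∎
    where
    open ≡-Reasoning
    P? = primeDivisor? n
    length-filter-[L] : length (filter P? [ L ]) ≡ indicator ⌊ P? L ⌋
    length-filter-[L] with prime? L | L ∣? n
    ... | yes _ | yes _ = refl
    ... | yes _ | no _ = refl
    ... | no _ | _ = refl

  #primeDivisors<-stable : ∀ n j → 1 ≤ n → #primeDivisors< (suc n + j) n ≡ #primeDivisors< (suc n) n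
  #primeDivisors<-stable n zero _ = cong (λ L → #primeDivisors< L n) (+-identityʳ (suc n))
  #primeDivisors<-stable n (suc j) 1≤n rewrite +-suc n j =
    trans (#primeDivisors<-suc (suc n + j) n)
      (trans (cong₂ _+_ (#primeDivisors<-stable n j 1≤n) (indicator-no (primeDivisor? n (suc n + j)) too-big))
             (+-identityʳ _))
    where
    too-big : ¬ PrimeDivisor n (suc n + j)
    too-big (_ , h) = <-irrefl refl (<-≤-trans (s≤s (m≤m+n n j)) (∣⇒≤ {{ℕ.>-nonZero 1≤n}} h))

  primeDivisor-p* : ∀ {p a q} → Prime p → q ≢ p → PrimeDivisor (p * a) q → PrimeDivisor a q
  primeDivisor-p* {p} {a} pp q≢p (pq , h) with euclidsLemma p a pq h
  ... | inj₁ q∣p = ⊥-elim (q≢p (prime∣prime⇒≡ pp pq q∣p))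
  ... | inj₂ q∣a = pq , q∣a

  #primeDivisors<-p* : ∀ {p a} → Prime p → ¬ p ∣ a → ∀ L →
    #primeDivisors< L (p * a) ≡ indicator ⌊ p <? L ⌋ + #primeDivisors< L a
  #primeDivisors<-p* pp p∤a zero = refl
  #primeDivisors<-p* {p} {a} pp p∤a (suc L)
    rewrite #primeDivisors<-suc L (p * a) | #primeDivisors<-suc L a | #primeDivisors<-p* pp p∤a L with L ≟ p
  ... | yes refl
    rewrite indicator-yes (primeDivisor? (p * a) p) (pp , m∣m*n a) | indicator-no (primeDivisor? a p) (λ (_ , h) → p∤a h)
          | indicator-no (p <? p) (<-irrefl refl) | indicator-yes (p <? suc p) (n<1+n p)
          = trans (+-comm _ 1) (cong suc (sym (+-identityʳ _)))
  ... | no L≢p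
    rewrite ⌊⌋-⇔ (primeDivisor-p* pp L≢p) (λ (pL , h) → pL , ∣n⇒∣m*n p h) (primeDivisor? (p * a) L) (primeDivisor? a L)
          | ⌊⌋-⇔ (λ h → ≤∧≢⇒< (≤-pred h) (L≢p ∘ sym)) m<n⇒m<1+n (p <? suc L) (p <? L)
          = +-assoc (indicator ⌊ p <? L ⌋) (#primeDivisors< L a) _

  length-primeDivisors-p* : ∀ {p a} → 1 ≤ a → Prime p → ¬ p ∣ a →
    length (primeDivisors (p * a)) ≡ suc (length (primeDivisors a))
  length-primeDivisors-p* {p} {a} 1≤a pp p∤a with m≤n⇒∃[o]m+o≡n (*-monoˡ-≤ a (prime⇒1≤ pp))
  ... | j , 1*a+j≡p*a = begin
    #primeDivisors< (suc (p * a)) (p * a)          ≡⟨ #primeDivisors<-p* pp p∤a (suc (p * a)) ⟩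
    indicator ⌊ p <? suc (p * a) ⌋ + #primeDivisors< (suc (p * a)) a
      ≡⟨ cong₂ _+_ (indicator-yes (p <? suc (p * a)) (s≤s (m≤m*n p a {{ℕ.>-nonZero 1≤a}})))
                  (trans (cong (λ L → #primeDivisors< (suc L) a) (sym a+j≡p*a)) (#primeDivisors<-stable a j 1≤a)) ⟩
    suc (#primeDivisors< (suc a) a)                ∎
    where
    open ≡-Reasoning
    a+j≡p*a : a + j ≡ p * a
    a+j≡p*a = trans (cong (_+ j) (sym (*-identityˡ a))) 1*a+j≡p*a

  μ-p*-coprime : ∀ {p a} → 1 ≤ a → Prime p → ¬ p ∣ a → μ (p * a) ≡ ℤ.- μ a
  μ-p*-coprime {p} {a} 1≤a pp p∤a with squarefree (p * a) | squarefree-p* 1≤a pp p∤a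
  ... | _ | refl with squarefree a
  ...   | false = refl
  ...   | true rewrite length-primeDivisors-p* 1≤a pp p∤a = -1*i≡-i _

module FiniteSums {c ℓ : Level} (R : CommutativeRing c ℓ) where

  open CommutativeRing R hiding (zero)
  open import Algebra.Properties.Ring ring using (-0#≈0#; -‿+-comm)
  open CommutativeSemigroupProperties +-commutativeSemigroup using (interchange; x∙yz≈y∙xz)
  open import Relation.Binary.Reasoning.Setoid setoid

  private
    variable
      a : Level
      A B : Set a

  when : Bool → Carrier → Carrier
  when b x = if b then x else 0#

  when-cong : ∀ b {x y} → x ≈ y → when b x ≈ when b y
  when-cong true x≈y = x≈y
  when-cong false _ = refl

  when-*ˡ : ∀ b x y → x * when b y ≈ when b (x * y)
  when-*ˡ true x y = refl
  when-*ˡ false x y = zeroʳ x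

  when-*ʳ : ∀ b x y → when b x * y ≈ when b (x * y)
  when-*ʳ true x y = refl
  when-*ʳ false x y = zeroˡ y

  when-1#-* : ∀ b x → when b 1# * x ≈ when b x
  when-1#-* b x = trans (when-*ʳ b 1# x) (when-cong b (*-identityˡ x))

  -‿when : ∀ b x → - when b x ≈ when b (- x)
  -‿when true x = refl
  -‿when false x = -0#≈0#

  when-+ : ∀ b x y → when b (x + y) ≈ when b x + when b y
  when-+ true x y = refl
  when-+ false x y = sym (+-identityˡ 0#)

  when-comm : ∀ b₁ b₂ x → when b₁ (when b₂ x) ≈ when b₂ (when b₁ x)
  when-comm true true x = refl
  when-comm true false x = refl
  when-comm false true x = refl
  when-comm false false x = refl

  when-zero : ∀ b {x} → x ≈ 0# → when b x ≈ 0#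
  when-zero true x≈0 = x≈0
  when-zero false _ = refl

  when-holds : ∀ {p} {P : Set p} (P? : Dec P) → P → ∀ x → when ⌊ P? ⌋ x ≈ x
  when-holds (yes _) _ x = refl
  when-holds (no ¬p) p x = ⊥-elim (¬p p)

  when-fails : ∀ {p} {P : Set p} (P? : Dec P) → ¬ P → ∀ x → when ⌊ P? ⌋ x ≈ 0#
  when-fails (yes p) ¬p x = ⊥-elim (¬p p)
  when-fails (no _) _ x = refl

  when-⇔ : ∀ {p q} {P : Set p} {Q : Set q} (P? : Dec P) (Q? : Dec Q) →
    (P → Q) → (Q → P) → ∀ x → when ⌊ P? ⌋ x ≈ when ⌊ Q? ⌋ x
  when-⇔ (yes _) (yes _) _ _ x = refl
  when-⇔ (no _) (no _) _ _ x = refl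
  when-⇔ (yes p) (no ¬q) f _ x = ⊥-elim (¬q (f p))
  when-⇔ (no ¬p) (yes q) _ g x = ⊥-elim (¬p (g q))

  when-≟-sym : ∀ m n x → when ⌊ m ≟ n ⌋ x ≈ when ⌊ n ≟ m ⌋ x
  when-≟-sym m n = when-⇔ (m ≟ n) (n ≟ m) ≡.sym ≡.sym

  Σℓ : List A → (A → Carrier) → Carrier
  Σℓ xs h = sumR R (map h xs)

  Σℓ-++ : ∀ (xs ys : List A) h → Σℓ (xs ++ ys) h ≈ Σℓ xs h + Σℓ ys h
  Σℓ-++ [] ys h = sym (+-identityˡ _)
  Σℓ-++ (x ∷ xs) ys h = trans (+-congˡ (Σℓ-++ xs ys h)) (sym (+-assoc _ _ _))

  Σℓ-map : ∀ (f : A → B) xs h → Σℓ (map f xs) h ≡ Σℓ xs (h ∘ f)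
  Σℓ-map f [] h = ≡.refl
  Σℓ-map f (x ∷ xs) h = ≡.cong (h (f x) +_) (Σℓ-map f xs h)

  Σℓ-concatMap : ∀ (f : A → List B) xs h → Σℓ (concatMap f xs) h ≈ Σℓ xs (λ x → Σℓ (f x) h)
  Σℓ-concatMap f [] h = refl
  Σℓ-concatMap f (x ∷ xs) h = trans (Σℓ-++ (f x) (concatMap f xs) h) (+-congˡ (Σℓ-concatMap f xs h))

  Σℓ-cong : ∀ (xs : List A) {f g} → (∀ x → f x ≈ g x) → Σℓ xs f ≈ Σℓ xs g
  Σℓ-cong [] _ = refl
  Σℓ-cong (x ∷ xs) f≈g = +-cong (f≈g x) (Σℓ-cong xs f≈g)

  Σℓ-cong-∈ : ∀ (xs : List A) {f g} → (∀ {x} → x ∈ xs → f x ≈ g x) → Σℓ xs f ≈ Σℓ xs g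
  Σℓ-cong-∈ [] _ = refl
  Σℓ-cong-∈ (x ∷ xs) f≈g = +-cong (f≈g (here ≡.refl)) (Σℓ-cong-∈ xs (f≈g ∘ there))

  Σℓ-zero : ∀ (xs : List A) {f} → (∀ x → f x ≈ 0#) → Σℓ xs f ≈ 0#
  Σℓ-zero [] _ = refl
  Σℓ-zero (x ∷ xs) f≈0 = trans (+-cong (f≈0 x) (Σℓ-zero xs f≈0)) (+-identityˡ 0#)

  Σℓ-+ : ∀ (xs : List A) f g → Σℓ xs (λ x → f x + g x) ≈ Σℓ xs f + Σℓ xs g
  Σℓ-+ [] f g = sym (+-identityˡ _)
  Σℓ-+ (x ∷ xs) f g = trans (+-congˡ (Σℓ-+ xs f g)) (interchange (f x) (g x) _ _)

  Σℓ-neg : ∀ (xs : List A) f → Σℓ xs (λ x → - f x) ≈ - Σℓ xs f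
  Σℓ-neg [] f = sym -0#≈0#
  Σℓ-neg (x ∷ xs) f = trans (+-congˡ (Σℓ-neg xs f)) (-‿+-comm (f x) (Σℓ xs f))

  Σℓ-*ˡ : ∀ (xs : List A) k f → k * Σℓ xs f ≈ Σℓ xs (λ x → k * f x)
  Σℓ-*ˡ [] k f = zeroʳ k
  Σℓ-*ˡ (x ∷ xs) k f = trans (distribˡ k _ _) (+-congˡ (Σℓ-*ˡ xs k f))

  Σℓ-*ʳ : ∀ (xs : List A) k f → Σℓ xs f * k ≈ Σℓ xs (λ x → f x * k)
  Σℓ-*ʳ xs k f = trans (*-comm _ k) (trans (Σℓ-*ˡ xs k f) (Σℓ-cong xs (λ x → *-comm k (f x))))

  Σℓ-when : ∀ b (xs : List A) f → when b (Σℓ xs f) ≈ Σℓ xs (λ x → when b (f x))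
  Σℓ-when b xs f = trans (sym (when-1#-* b _)) (trans (Σℓ-*ˡ xs _ f) (Σℓ-cong xs (λ x → when-1#-* b (f x))))

  Σℓ-comm : ∀ (xs : List A) (ys : List B) (h : A → B → Carrier) →
    Σℓ xs (λ x → Σℓ ys (h x)) ≈ Σℓ ys (λ y → Σℓ xs (λ x → h x y))
  Σℓ-comm [] ys h = sym (Σℓ-zero ys (λ _ → refl))
  Σℓ-comm (x ∷ xs) ys h = trans (+-congˡ (Σℓ-comm xs ys h)) (sym (Σℓ-+ ys (h x) _))

  Σℓ-filter-split : ∀ {p} {P : A → Set p} (P? : ∀ x → Dec (P x)) xs h →
    Σℓ xs h ≈ Σℓ (filter P? xs) h + Σℓ xs (λ x → when (Data.Bool.not ⌊ P? x ⌋) (h x))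
  Σℓ-filter-split P? [] h = sym (+-identityˡ 0#)
  Σℓ-filter-split P? (x ∷ xs) h with P? x
  ... | yes _ = trans (+-congˡ (Σℓ-filter-split P? xs h))
                      (trans (sym (+-assoc _ _ _)) (+-congˡ (sym (+-identityˡ _))))
  ... | no _ = trans (+-congˡ (Σℓ-filter-split P? xs h)) (x∙yz≈y∙xz (h x) _ _)

  Σ≤ : ℕ → (ℕ → Carrier) → Carrier
  Σ≤ zero h = 0#
  Σ≤ (suc n) h = Σ≤ n h + h (suc n)

  Σℓ-range1 : ∀ n (h : ℕ → Carrier) → Σℓ (range1 n) h ≈ Σ≤ n h
  Σℓ-range1 zero h = refl
  Σℓ-range1 (suc n) h = begin
    Σℓ (map suc (upTo (suc n))) h        ≡⟨ ≡.cong (λ l → Σℓ (map suc l) h) (≡.sym (upTo-∷ʳ n)) ⟩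
    Σℓ (map suc (upTo n ++ [ n ])) h     ≡⟨ ≡.cong (λ l → Σℓ l h) (map-++ suc (upTo n) [ n ]) ⟩
    Σℓ (range1 n ++ [ suc n ]) h         ≈⟨ Σℓ-++ (range1 n) [ suc n ] h ⟩
    Σℓ (range1 n) h + (h (suc n) + 0#)   ≈⟨ +-cong (Σℓ-range1 n h) (+-identityʳ _) ⟩
    Σ≤ n h + h (suc n)                   ∎

  Σ≤-cong : ∀ n {f g : ℕ → Carrier} → (∀ a → 1 ≤ a → a ≤ n → f a ≈ g a) → Σ≤ n f ≈ Σ≤ n g
  Σ≤-cong zero _ = refl
  Σ≤-cong (suc n) f≈g =
    +-cong (Σ≤-cong n (λ a 1≤a a≤n → f≈g a 1≤a (ℕₚ.m≤n⇒m≤1+n a≤n))) (f≈g (suc n) (s≤s z≤n) ℕₚ.≤-refl)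

  Σ≤-zero : ∀ n {f : ℕ → Carrier} → (∀ a → 1 ≤ a → a ≤ n → f a ≈ 0#) → Σ≤ n f ≈ 0#
  Σ≤-zero zero _ = refl
  Σ≤-zero (suc n) f≈0 =
    trans (+-cong (Σ≤-zero n (λ a 1≤a a≤n → f≈0 a 1≤a (ℕₚ.m≤n⇒m≤1+n a≤n))) (f≈0 (suc n) (s≤s z≤n) ℕₚ.≤-refl))
          (+-identityˡ 0#)

  Σ≤-+ : ∀ n (f g : ℕ → Carrier) → Σ≤ n (λ x → f x + g x) ≈ Σ≤ n f + Σ≤ n g
  Σ≤-+ zero f g = sym (+-identityˡ 0#)
  Σ≤-+ (suc n) f g = trans (+-congʳ (Σ≤-+ n f g)) (interchange _ _ _ _)

  Σ≤-neg : ∀ n (f : ℕ → Carrier) → Σ≤ n (λ x → - f x) ≈ - Σ≤ n f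
  Σ≤-neg zero f = sym -0#≈0#
  Σ≤-neg (suc n) f = trans (+-congʳ (Σ≤-neg n f)) (-‿+-comm _ _)

  Σ≤-*ˡ : ∀ n k (f : ℕ → Carrier) → k * Σ≤ n f ≈ Σ≤ n (λ x → k * f x)
  Σ≤-*ˡ zero k f = zeroʳ k
  Σ≤-*ˡ (suc n) k f = trans (distribˡ k _ _) (+-congʳ (Σ≤-*ˡ n k f))

  Σ≤-*ʳ : ∀ n k (f : ℕ → Carrier) → Σ≤ n f * k ≈ Σ≤ n (λ x → f x * k)
  Σ≤-*ʳ n k f = trans (*-comm _ k) (trans (Σ≤-*ˡ n k f) (Σ≤-cong n (λ x _ _ → *-comm k (f x))))

  Σ≤-when : ∀ b n f → when b (Σ≤ n f) ≈ Σ≤ n (λ x → when b (f x))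
  Σ≤-when b n f = trans (sym (when-1#-* b _)) (trans (Σ≤-*ˡ n _ f) (Σ≤-cong n (λ x _ _ → when-1#-* b (f x))))

  Σ≤-Σℓ : ∀ n (xs : List A) (h : ℕ → A → Carrier) →
    Σ≤ n (λ a → Σℓ xs (h a)) ≈ Σℓ xs (λ x → Σ≤ n (λ a → h a x))
  Σ≤-Σℓ zero xs h = sym (Σℓ-zero xs (λ _ → refl))
  Σ≤-Σℓ (suc n) xs h = trans (+-congʳ (Σ≤-Σℓ n xs h)) (sym (Σℓ-+ xs _ _))

  Σ≤-comm : ∀ n m (h : ℕ → ℕ → Carrier) → Σ≤ n (λ a → Σ≤ m (h a)) ≈ Σ≤ m (λ b → Σ≤ n (λ a → h a b))
  Σ≤-comm zero m h = sym (Σ≤-zero m (λ _ _ _ → refl))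
  Σ≤-comm (suc n) m h = trans (+-congʳ (Σ≤-comm n m h)) (sym (Σ≤-+ m (λ b → Σ≤ n (λ a → h a b)) (h (suc n))))

  Σ≤-+-split : ∀ m k f → Σ≤ (m ℕ.+ k) f ≈ Σ≤ m f + Σ≤ k (λ j → f (m ℕ.+ j))
  Σ≤-+-split m zero f rewrite ℕₚ.+-identityʳ m = sym (+-identityʳ _)
  Σ≤-+-split m (suc k) f rewrite ℕₚ.+-suc m k = trans (+-congʳ (Σ≤-+-split m k f)) (+-assoc _ _ _)

  Σ≤-extend : ∀ {m n} (f : ℕ → Carrier) → m ≤ n → (∀ a → m < a → a ≤ n → f a ≈ 0#) → Σ≤ n f ≈ Σ≤ m f
  Σ≤-extend {m} f m≤n tail≈0 with ℕₚ.m≤n⇒∃[o]m+o≡n m≤n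
  ... | k , ≡.refl = trans (Σ≤-+-split m k f)
    (trans (+-congˡ (Σ≤-zero k (λ j 1≤j j≤k → tail≈0 (m ℕ.+ j) (ℕₚ.m<m+n m 1≤j) (ℕₚ.+-monoʳ-≤ m j≤k))))
           (+-identityʳ _))

  Σ≤-δ : ∀ n u (h : ℕ → Carrier) → 1 ≤ u → u ≤ n → Σ≤ n (λ a → when ⌊ a ≟ u ⌋ (h a)) ≈ h u
  Σ≤-δ zero (suc _) h _ ()
  Σ≤-δ (suc n) u h 1≤u u≤n with u ≟ suc n
  ... | yes ≡.refl = trans (+-cong (Σ≤-zero n (λ a _ a≤n → when-fails (a ≟ suc n) (ℕₚ.<⇒≢ (s≤s a≤n)) (h a)))
                                   (when-holds (suc n ≟ suc n) ≡.refl (h (suc n))))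
                           (+-identityˡ _)
  ... | no u≢ = trans (+-cong (Σ≤-δ n u h 1≤u (ℕₚ.≤-pred (ℕₚ.≤∧≢⇒< u≤n u≢)))
                              (when-fails (suc n ≟ u) (u≢ ∘ ≡.sym) _))
                      (+-identityʳ _)

  Σ≤-δ-out : ∀ n u (h : ℕ → Carrier) → n < u → Σ≤ n (λ a → when ⌊ a ≟ u ⌋ (h a)) ≈ 0#
  Σ≤-δ-out n u h n<u = Σ≤-zero n (λ a _ a≤n → when-fails (a ≟ u) (ℕₚ.<⇒≢ (ℕₚ.≤-<-trans a≤n n<u)) _)

  Σ≤-δ-vanishing : ∀ n u (h : ℕ → Carrier) → 1 ≤ u → (n < u → h u ≈ 0#) →
    Σ≤ n (λ a → when ⌊ a ≟ u ⌋ (h a)) ≈ h u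
  Σ≤-δ-vanishing n u h 1≤u h≈0 with u ≤? n
  ... | yes u≤n = Σ≤-δ n u h 1≤u u≤n
  ... | no u≰n = trans (Σ≤-δ-out n u h (ℕₚ.≰⇒> u≰n)) (sym (h≈0 (ℕₚ.≰⇒> u≰n)))

  Σ≤-δ-≤? : ∀ n u (h : ℕ → Carrier) → 1 ≤ u →
    Σ≤ n (λ a → when ⌊ a ≟ u ⌋ (h a)) ≈ when ⌊ u ≤? n ⌋ (h u)
  Σ≤-δ-≤? n u h 1≤u with u ≤? n
  ... | yes u≤n = Σ≤-δ n u h 1≤u u≤n
  ... | no u≰n = Σ≤-δ-out n u h (ℕₚ.≰⇒> u≰n)

module NatBounds where

  m≤m*n : ∀ m {n} → 1 ≤ n → m ≤ m ℕ.* n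
  m≤m*n m 1≤n = ℕₚ.m≤m*n m _ {{ℕ.>-nonZero 1≤n}}

  m≤n*m : ∀ m {n} → 1 ≤ n → m ≤ n ℕ.* m
  m≤n*m m 1≤n = ℕₚ.m≤n*m m _ {{ℕ.>-nonZero 1≤n}}

  1≤prodℕ : ∀ m (t : Fin m → ℕ) → (∀ i → 1 ≤ t i) → 1 ≤ prodℕ m t
  1≤prodℕ zero t _ = s≤s z≤n
  1≤prodℕ (suc m) t 1≤t = ℕₚ.*-mono-≤ (1≤t fzero) (1≤prodℕ m (t ∘ fsuc) (1≤t ∘ fsuc))

module Tuples where

  ∈-tuples⇒∈ : ∀ m (B : Fin m → List ℕ) {t} → t ∈ tuples m B → ∀ i → t i ∈ B i
  ∈-tuples⇒∈ (suc m) B t∈ i with find (∈-concatMap⁻ (λ x → map (cons x) (tuples m (B ∘ fsuc))) {xs = B fzero} t∈)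
  ... | x , x∈ , t∈′ with ∈-map⁻ (cons x) t∈′
  ...   | t′ , t′∈ , ≡.refl with i
  ...     | fzero = x∈
  ...     | fsuc j = ∈-tuples⇒∈ m (B ∘ fsuc) t′∈ j

  ∈-range1⇒1≤ : ∀ {N x} → x ∈ range1 N → 1 ≤ x
  ∈-range1⇒1≤ x∈ with ∈-map⁻ suc x∈
  ... | _ , _ , ≡.refl = s≤s z≤n

module DirichletConvolution {c ℓ : Level} (R : CommutativeRing c ℓ) where

  open CommutativeRing R hiding (zero)
  open import Algebra.Properties.Ring ring using (-‿distribʳ-*)
  open CommutativeSemigroupProperties *-commutativeSemigroup using (x∙yz≈y∙xz)
  open import Relation.Binary.Reasoning.Setoid setoid
  open FiniteSums R
  open NatBounds
  open Tuples

  private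
    variable
      a : Level
      A : Set a

  ArithFn : Set c
  ArithFn = ℕ → Carrier

  -- a · b = n ≥ 1 forces a, b ≤ n, so this is the full Dirichlet convolution at every n ≥ 1.
  infixl 7 _⋆_
  _⋆_ : ArithFn → ArithFn → ArithFn
  (F ⋆ G) n = Σ≤ n (λ a → Σ≤ n (λ b → when ⌊ a ℕ.* b ≟ n ⌋ (F a * G b)))

  δ : ArithFn
  δ n = when ⌊ n ≟ 1 ⌋ 1#

  AgreeUpTo : ℕ → ArithFn → ArithFn → Set ℓ
  AgreeUpTo n F G = ∀ m → 1 ≤ m → m ≤ n → F m ≈ G m

  VanishesBelow : ℕ → ℕ → ArithFn → Set ℓ
  VanishesBelow p K F = ∀ n → 1 ≤ n → n ≤ K → n < p → F n ≈ 0#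

  pushforward : List A → (A → ℕ) → (A → Carrier) → ArithFn
  pushforward S p w n = Σℓ S (λ s → when ⌊ p s ≟ n ⌋ (w s))

  Π⋆ : (m : ℕ) → (Fin m → ArithFn) → ArithFn
  Π⋆ zero F = δ
  Π⋆ (suc m) F = F fzero ⋆ Π⋆ m (F ∘ fsuc)

  ⋆-cong : ∀ {F F′ G G′} n → AgreeUpTo n F F′ → AgreeUpTo n G G′ → (F ⋆ G) n ≈ (F′ ⋆ G′) n
  ⋆-cong n F≈F′ G≈G′ = Σ≤-cong n (λ a 1≤a a≤n → Σ≤-cong n (λ b 1≤b b≤n →
    when-cong ⌊ a ℕ.* b ≟ n ⌋ (*-cong (F≈F′ a 1≤a a≤n) (G≈G′ b 1≤b b≤n))))

  ⋆-congˡ : ∀ {F F′} G n → AgreeUpTo n F F′ → (F ⋆ G) n ≈ (F′ ⋆ G) n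
  ⋆-congˡ G n F≈F′ = ⋆-cong n F≈F′ (λ _ _ _ → refl)

  ⋆-congʳ : ∀ F {G G′} n → AgreeUpTo n G G′ → (F ⋆ G) n ≈ (F ⋆ G′) n
  ⋆-congʳ F n G≈G′ = ⋆-cong n (λ _ _ _ → refl) G≈G′

  ⋆-comm : ∀ F G n → (F ⋆ G) n ≈ (G ⋆ F) n
  ⋆-comm F G n = trans (Σ≤-comm n n _) (Σ≤-cong n (λ b _ _ → Σ≤-cong n (λ a _ _ →
    trans (when-⇔ (a ℕ.* b ≟ n) (b ℕ.* a ≟ n) (≡.trans (ℕₚ.*-comm b a)) (≡.trans (ℕₚ.*-comm a b)) _)
          (when-cong ⌊ b ℕ.* a ≟ n ⌋ (*-comm (F a) (G b))))))

  ⋆-identityˡ : ∀ F n → 1 ≤ n → (δ ⋆ F) n ≈ F n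
  ⋆-identityˡ F n 1≤n = begin
    Σ≤ n (λ a → Σ≤ n (λ b → when ⌊ a ℕ.* b ≟ n ⌋ (δ a * F b)))
      ≈⟨ Σ≤-cong n (λ a _ _ → Σ≤-cong n (λ b _ _ →
           trans (when-cong ⌊ a ℕ.* b ≟ n ⌋ (when-1#-* ⌊ a ≟ 1 ⌋ (F b))) (when-comm ⌊ a ℕ.* b ≟ n ⌋ ⌊ a ≟ 1 ⌋ _))) ⟩
    Σ≤ n (λ a → Σ≤ n (λ b → when ⌊ a ≟ 1 ⌋ (when ⌊ a ℕ.* b ≟ n ⌋ (F b))))
      ≈⟨ Σ≤-cong n (λ a _ _ → sym (Σ≤-when ⌊ a ≟ 1 ⌋ n _)) ⟩
    Σ≤ n (λ a → when ⌊ a ≟ 1 ⌋ (Σ≤ n (λ b → when ⌊ a ℕ.* b ≟ n ⌋ (F b))))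
      ≈⟨ Σ≤-δ n 1 _ (s≤s z≤n) 1≤n ⟩
    Σ≤ n (λ b → when ⌊ 1 ℕ.* b ≟ n ⌋ (F b))
      ≈⟨ Σ≤-cong n (λ b _ _ → when-⇔ (1 ℕ.* b ≟ n) (b ≟ n)
           (≡.trans (≡.sym (ℕₚ.*-identityˡ b))) (≡.trans (ℕₚ.*-identityˡ b)) (F b)) ⟩
    Σ≤ n (λ b → when ⌊ b ≟ n ⌋ (F b))
      ≈⟨ Σ≤-δ n n F 1≤n ℕₚ.≤-refl ⟩
    F n ∎

  ⋆-identityʳ : ∀ F n → 1 ≤ n → (F ⋆ δ) n ≈ F n
  ⋆-identityʳ F n 1≤n = trans (⋆-comm F δ n) (⋆-identityˡ F n 1≤n)

  ⋆-Σℓ : ∀ F (xs : List A) (G : A → ArithFn) n →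
    (F ⋆ (λ m → Σℓ xs (λ x → G x m))) n ≈ Σℓ xs (λ x → (F ⋆ G x) n)
  ⋆-Σℓ F xs G n = begin
    Σ≤ n (λ a → Σ≤ n (λ b → when ⌊ a ℕ.* b ≟ n ⌋ (F a * Σℓ xs (λ x → G x b))))
      ≈⟨ Σ≤-cong n (λ a _ _ → Σ≤-cong n (λ b _ _ →
           trans (when-cong ⌊ a ℕ.* b ≟ n ⌋ (Σℓ-*ˡ xs (F a) _)) (Σℓ-when ⌊ a ℕ.* b ≟ n ⌋ xs _))) ⟩
    Σ≤ n (λ a → Σ≤ n (λ b → Σℓ xs (λ x → when ⌊ a ℕ.* b ≟ n ⌋ (F a * G x b))))
      ≈⟨ Σ≤-cong n (λ a _ _ → Σ≤-Σℓ n xs _) ⟩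
    Σ≤ n (λ a → Σℓ xs (λ x → Σ≤ n (λ b → when ⌊ a ℕ.* b ≟ n ⌋ (F a * G x b))))
      ≈⟨ Σ≤-Σℓ n xs _ ⟩
    Σℓ xs (λ x → (F ⋆ G x) n) ∎

  ⋆-scaleʳ : ∀ F G k n → (F ⋆ (λ m → k * G m)) n ≈ k * (F ⋆ G) n
  ⋆-scaleʳ F G k n = sym (begin
    k * Σ≤ n (λ a → Σ≤ n (λ b → when ⌊ a ℕ.* b ≟ n ⌋ (F a * G b)))
      ≈⟨ Σ≤-*ˡ n k _ ⟩
    Σ≤ n (λ a → k * Σ≤ n (λ b → when ⌊ a ℕ.* b ≟ n ⌋ (F a * G b)))
      ≈⟨ Σ≤-cong n (λ a _ _ → Σ≤-*ˡ n k _) ⟩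
    Σ≤ n (λ a → Σ≤ n (λ b → k * when ⌊ a ℕ.* b ≟ n ⌋ (F a * G b)))
      ≈⟨ Σ≤-cong n (λ a _ _ → Σ≤-cong n (λ b _ _ → trans (when-*ˡ ⌊ a ℕ.* b ≟ n ⌋ k _)
           (when-cong ⌊ a ℕ.* b ≟ n ⌋ (x∙yz≈y∙xz k (F a) (G b))))) ⟩
    Σ≤ n (λ a → Σ≤ n (λ b → when ⌊ a ℕ.* b ≟ n ⌋ (F a * (k * G b)))) ∎)

  ⋆-linearʳ : ∀ F (xs : List A) (k : A → Carrier) (G : A → ArithFn) n →
    (F ⋆ (λ m → Σℓ xs (λ x → k x * G x m))) n ≈ Σℓ xs (λ x → k x * (F ⋆ G x) n)
  ⋆-linearʳ F xs k G n = trans (⋆-Σℓ F xs (λ x m → k x * G x m) n) (Σℓ-cong xs (λ x → ⋆-scaleʳ F (G x) (k x) n))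

  ⋆-whenʳ : ∀ F G b n → (F ⋆ (λ m → when b (G m))) n ≈ when b ((F ⋆ G) n)
  ⋆-whenʳ F G b n = trans (⋆-congʳ F n (λ m _ _ → sym (when-1#-* b (G m))))
                          (trans (⋆-scaleʳ F G (when b 1#) n) (when-1#-* b _))

  ⋆-distribˡ-+ : ∀ F G H n → (F ⋆ (λ m → G m + H m)) n ≈ (F ⋆ G) n + (F ⋆ H) n
  ⋆-distribˡ-+ F G H n =
    trans (Σ≤-cong n (λ a _ _ → Σ≤-cong n (λ b _ _ →
            trans (when-cong ⌊ a ℕ.* b ≟ n ⌋ (distribˡ (F a) (G b) (H b))) (when-+ ⌊ a ℕ.* b ≟ n ⌋ _ _))))
          (trans (Σ≤-cong n (λ a _ _ → Σ≤-+ n _ _)) (Σ≤-+ n _ _))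

  ⋆-negʳ : ∀ F G n → (F ⋆ (λ m → - G m)) n ≈ - (F ⋆ G) n
  ⋆-negʳ F G n =
    trans (Σ≤-cong n (λ a _ _ → Σ≤-cong n (λ b _ _ →
            trans (when-cong ⌊ a ℕ.* b ≟ n ⌋ (sym (-‿distribʳ-* (F a) (G b)))) (sym (-‿when ⌊ a ℕ.* b ≟ n ⌋ _)))))
          (trans (Σ≤-cong n (λ a _ _ → Σ≤-neg n _)) (Σ≤-neg n _))

  ⋆-extend : ∀ F G {n} x → 1 ≤ x → x ≤ n →
    (F ⋆ G) x ≈ Σ≤ n (λ a → Σ≤ n (λ b → when ⌊ a ℕ.* b ≟ x ⌋ (F a * G b)))
  ⋆-extend F G {n} x 1≤x x≤n = begin
    Σ≤ x (λ a → Σ≤ x (λ b → when ⌊ a ℕ.* b ≟ x ⌋ (F a * G b)))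
      ≈⟨ Σ≤-cong x (λ a 1≤a _ → sym (Σ≤-extend _ x≤n (λ b x<b _ →
           when-fails (a ℕ.* b ≟ x) (ℕₚ.>⇒≢ (ℕₚ.<-≤-trans x<b (m≤n*m b 1≤a))) _))) ⟩
    Σ≤ x (λ a → Σ≤ n (λ b → when ⌊ a ℕ.* b ≟ x ⌋ (F a * G b)))
      ≈⟨ sym (Σ≤-extend _ x≤n (λ a x<a _ → Σ≤-zero n (λ b 1≤b _ →
           when-fails (a ℕ.* b ≟ x) (ℕₚ.>⇒≢ (ℕₚ.<-≤-trans x<a (m≤m*n a 1≤b))) _))) ⟩
    Σ≤ n (λ a → Σ≤ n (λ b → when ⌊ a ℕ.* b ≟ x ⌋ (F a * G b))) ∎

  ⋆³ : ArithFn → ArithFn → ArithFn → ArithFn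
  ⋆³ F G H n = Σ≤ n (λ a → Σ≤ n (λ b → Σ≤ n (λ c → when ⌊ (a ℕ.* b) ℕ.* c ≟ n ⌋ (F a * G b * H c))))

  ⋆-assoc-⋆³ : ∀ F G H n → ((F ⋆ G) ⋆ H) n ≈ ⋆³ F G H n
  ⋆-assoc-⋆³ F G H n = begin
    Σ≤ n (λ x → Σ≤ n (λ c → when ⌊ x ℕ.* c ≟ n ⌋ ((F ⋆ G) x * H c)))
      ≈⟨ Σ≤-cong n (λ x 1≤x x≤n → Σ≤-cong n (λ c _ _ → when-cong ⌊ x ℕ.* c ≟ n ⌋
           (trans (*-congʳ (⋆-extend F G x 1≤x x≤n))
                  (trans (Σ≤-*ʳ n _ _) (Σ≤-cong n (λ a _ _ → trans (Σ≤-*ʳ n _ _)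
                    (Σ≤-cong n (λ b _ _ → when-*ʳ ⌊ a ℕ.* b ≟ x ⌋ _ _)))))))) ⟩
    Σ≤ n (λ x → Σ≤ n (λ c → when ⌊ x ℕ.* c ≟ n ⌋ (Σ≤ n (λ a → Σ≤ n (λ b → Z x c a b)))))
      ≈⟨ Σ≤-cong n (λ x _ _ → Σ≤-cong n (λ c _ _ →
           trans (Σ≤-when ⌊ x ℕ.* c ≟ n ⌋ n _) (Σ≤-cong n (λ a _ _ → Σ≤-when ⌊ x ℕ.* c ≟ n ⌋ n _)))) ⟩
    Σ≤ n (λ x → Σ≤ n (λ c → Σ≤ n (λ a → Σ≤ n (λ b → when ⌊ x ℕ.* c ≟ n ⌋ (Z x c a b)))))
      ≈⟨ trans (Σ≤-comm n n _) (Σ≤-cong n (λ c _ _ → Σ≤-comm n n _)) ⟩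
    Σ≤ n (λ c → Σ≤ n (λ a → Σ≤ n (λ x → Σ≤ n (λ b → when ⌊ x ℕ.* c ≟ n ⌋ (Z x c a b)))))
      ≈⟨ trans (Σ≤-cong n (λ c _ _ → Σ≤-cong n (λ a _ _ → Σ≤-comm n n _)))
               (trans (Σ≤-comm n n _) (Σ≤-cong n (λ a _ _ → Σ≤-comm n n _))) ⟩
    Σ≤ n (λ a → Σ≤ n (λ b → Σ≤ n (λ c → Σ≤ n (λ x → when ⌊ x ℕ.* c ≟ n ⌋ (Z x c a b)))))
      ≈⟨ Σ≤-cong n (λ a 1≤a _ → Σ≤-cong n (λ b 1≤b _ → Σ≤-cong n (λ c 1≤c _ →
           collapse a b c 1≤a 1≤b 1≤c))) ⟩
    ⋆³ F G H n ∎
    where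
    Z : ℕ → ℕ → ℕ → ℕ → Carrier
    Z x c a b = when ⌊ a ℕ.* b ≟ x ⌋ (F a * G b * H c)
    collapse : ∀ a b c → 1 ≤ a → 1 ≤ b → 1 ≤ c →
      Σ≤ n (λ x → when ⌊ x ℕ.* c ≟ n ⌋ (Z x c a b)) ≈ when ⌊ (a ℕ.* b) ℕ.* c ≟ n ⌋ (F a * G b * H c)
    collapse a b c 1≤a 1≤b 1≤c =
      trans (Σ≤-cong n (λ x _ _ → trans (when-comm ⌊ x ℕ.* c ≟ n ⌋ ⌊ a ℕ.* b ≟ x ⌋ _) (when-≟-sym (a ℕ.* b) x _)))
            (Σ≤-δ-vanishing n (a ℕ.* b) _ (ℕₚ.*-mono-≤ 1≤a 1≤b)
              (λ n<ab → when-fails (a ℕ.* b ℕ.* c ≟ n) (ℕₚ.>⇒≢ (ℕₚ.<-≤-trans n<ab (m≤m*n (a ℕ.* b) 1≤c))) _))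

  ⋆-assoc : ∀ F G H n → ((F ⋆ G) ⋆ H) n ≈ (F ⋆ (G ⋆ H)) n
  ⋆-assoc F G H n = trans (⋆-assoc-⋆³ F G H n) (sym (begin
    (F ⋆ (G ⋆ H)) n ≈⟨ ⋆-comm F (G ⋆ H) n ⟩
    ((G ⋆ H) ⋆ F) n ≈⟨ ⋆-assoc-⋆³ G H F n ⟩
    Σ≤ n (λ b → Σ≤ n (λ c → Σ≤ n (λ a → when ⌊ (b ℕ.* c) ℕ.* a ≟ n ⌋ (G b * H c * F a))))
      ≈⟨ trans (Σ≤-cong n (λ b _ _ → Σ≤-comm n n _)) (Σ≤-comm n n _) ⟩
    Σ≤ n (λ a → Σ≤ n (λ b → Σ≤ n (λ c → when ⌊ (b ℕ.* c) ℕ.* a ≟ n ⌋ (G b * H c * F a))))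
      ≈⟨ Σ≤-cong n (λ a _ _ → Σ≤-cong n (λ b _ _ → Σ≤-cong n (λ c _ _ →
           trans (reflexive (≡.cong (λ m → when ⌊ m ≟ n ⌋ (G b * H c * F a)) (rotate a b c)))
                 (when-cong ⌊ (a ℕ.* b) ℕ.* c ≟ n ⌋ (trans (*-comm _ (F a)) (sym (*-assoc (F a) (G b) (H c)))))))) ⟩
    ⋆³ F G H n ∎))
    where
    rotate : ∀ a b c → (b ℕ.* c) ℕ.* a ≡ (a ℕ.* b) ℕ.* c
    rotate a b c = ≡.trans (ℕₚ.*-comm (b ℕ.* c) a) (≡.sym (ℕₚ.*-assoc a b c))

  ⋆-vanishesBelow : ∀ {p q K F G} → VanishesBelow p K F → VanishesBelow q K G → VanishesBelow (p ℕ.* q) K (F ⋆ G)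
  ⋆-vanishesBelow {p} {q} {K} {F} {G} F≈0 G≈0 n _ n≤K n<pq =
    Σ≤-zero n (λ a 1≤a a≤n → Σ≤-zero n (λ b 1≤b b≤n → term a b 1≤a 1≤b a≤n b≤n))
    where
    term : ∀ a b → 1 ≤ a → 1 ≤ b → a ≤ n → b ≤ n → when ⌊ a ℕ.* b ≟ n ⌋ (F a * G b) ≈ 0#
    term a b 1≤a 1≤b a≤n b≤n with a ℕ.* b ≟ n | a ℕ.<? p | b ℕ.<? q
    ... | no _ | _ | _ = refl
    ... | yes _ | yes a<p | _ = trans (*-congʳ (F≈0 a 1≤a (ℕₚ.≤-trans a≤n n≤K) a<p)) (zeroˡ _)
    ... | yes _ | no _ | yes b<q = trans (*-congˡ (G≈0 b 1≤b (ℕₚ.≤-trans b≤n n≤K) b<q)) (zeroʳ _)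
    ... | yes ab≡n | no a≮p | no b≮q = ⊥-elim (ℕₚ.<⇒≱ n<pq
          (≡.subst (p ℕ.* q ≤_) ab≡n (ℕₚ.*-mono-≤ (ℕₚ.≮⇒≥ a≮p) (ℕₚ.≮⇒≥ b≮q))))

  Σ≤-*-pushforward : ∀ n (T : List A) q w (f : ArithFn) →
    (∀ {t} → t ∈ T → 1 ≤ q t) → (∀ {t} → t ∈ T → n < q t → f (q t) ≈ 0#) →
    Σ≤ n (λ b → f b * pushforward T q w b) ≈ Σℓ T (λ t → f (q t) * w t)
  Σ≤-*-pushforward n T q w f 1≤q f≈0 = begin
    Σ≤ n (λ b → f b * Σℓ T (λ t → when ⌊ q t ≟ b ⌋ (w t)))
      ≈⟨ Σ≤-cong n (λ b _ _ → trans (Σℓ-*ˡ T (f b) _)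
           (Σℓ-cong T (λ t → trans (when-*ˡ ⌊ q t ≟ b ⌋ _ _) (when-≟-sym (q t) b _)))) ⟩
    Σ≤ n (λ b → Σℓ T (λ t → when ⌊ b ≟ q t ⌋ (f b * w t)))
      ≈⟨ Σ≤-Σℓ n T _ ⟩
    Σℓ T (λ t → Σ≤ n (λ b → when ⌊ b ≟ q t ⌋ (f b * w t)))
      ≈⟨ Σℓ-cong-∈ T (λ t∈ → Σ≤-δ-vanishing n _ _ (1≤q t∈) (λ n<q → trans (*-congʳ (f≈0 t∈ n<q)) (zeroˡ _))) ⟩
    Σℓ T (λ t → f (q t) * w t) ∎

  pushforward-⋆ˡ : ∀ (S : List A) p w G n → (∀ {s} → s ∈ S → 1 ≤ p s) →
    (pushforward S p w ⋆ G) n ≈ Σℓ S (λ s → Σ≤ n (λ b → when ⌊ p s ℕ.* b ≟ n ⌋ (G b)) * w s)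
  pushforward-⋆ˡ S p w G n 1≤p = begin
    Σ≤ n (λ a → Σ≤ n (λ b → when ⌊ a ℕ.* b ≟ n ⌋ (pushforward S p w a * G b)))
      ≈⟨ Σ≤-cong n (λ a _ _ → trans (Σ≤-cong n (λ b _ _ → sym (when-*ˡ ⌊ a ℕ.* b ≟ n ⌋ _ _)))
                                    (trans (sym (Σ≤-*ˡ n _ _)) (*-comm _ _))) ⟩
    Σ≤ n (λ a → Σ≤ n (λ b → when ⌊ a ℕ.* b ≟ n ⌋ (G b)) * pushforward S p w a)
      ≈⟨ Σ≤-*-pushforward n S p w _ 1≤p (λ s∈ n<p → Σ≤-zero n (λ b 1≤b _ →
           when-fails (p _ ℕ.* b ≟ n) (ℕₚ.>⇒≢ (ℕₚ.<-≤-trans n<p (m≤m*n _ 1≤b))) _)) ⟩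
    Σℓ S (λ s → Σ≤ n (λ b → when ⌊ p s ℕ.* b ≟ n ⌋ (G b)) * w s) ∎

  pushforward-⋆ : ∀ {b} {B : Set b} (S : List A) (T : List B) p q wS wT n →
    (∀ {s} → s ∈ S → 1 ≤ p s) → (∀ {t} → t ∈ T → 1 ≤ q t) →
    (pushforward S p wS ⋆ pushforward T q wT) n ≈ Σℓ S (λ s → Σℓ T (λ t → when ⌊ p s ℕ.* q t ≟ n ⌋ (wS s * wT t)))
  pushforward-⋆ S T p q wS wT n 1≤p 1≤q = begin
    (pushforward S p wS ⋆ pushforward T q wT) n
      ≈⟨ pushforward-⋆ˡ S p wS _ n 1≤p ⟩
    Σℓ S (λ s → Σ≤ n (λ b → when ⌊ p s ℕ.* b ≟ n ⌋ (pushforward T q wT b)) * wS s)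
      ≈⟨ Σℓ-cong-∈ S (λ {s} s∈ → *-congʳ (trans (Σ≤-cong n (λ b _ _ → sym (when-1#-* ⌊ p s ℕ.* b ≟ n ⌋ _)))
           (Σ≤-*-pushforward n T q wT _ 1≤q (λ t∈ n<q →
              when-fails (p s ℕ.* q _ ≟ n) (ℕₚ.>⇒≢ (ℕₚ.<-≤-trans n<q (m≤n*m _ (1≤p s∈)))) 1#)))) ⟩
    Σℓ S (λ s → Σℓ T (λ t → when ⌊ p s ℕ.* q t ≟ n ⌋ 1# * wT t) * wS s)
      ≈⟨ Σℓ-cong S (λ s → trans (Σℓ-*ʳ T _ _) (Σℓ-cong T (λ t →
           trans (*-congʳ (when-1#-* ⌊ p s ℕ.* q t ≟ n ⌋ _)) (trans (when-*ʳ ⌊ p s ℕ.* q t ≟ n ⌋ _ _)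
                 (when-cong ⌊ p s ℕ.* q t ≟ n ⌋ (*-comm _ _)))))) ⟩
    Σℓ S (λ s → Σℓ T (λ t → when ⌊ p s ℕ.* q t ≟ n ⌋ (wS s * wT t))) ∎

  pushforward-tuples : ∀ m (B : Fin m → List ℕ) (F : Fin m → ArithFn) → (∀ i {x} → x ∈ B i → 1 ≤ x) →
    ∀ n → 1 ≤ n →
    pushforward (tuples m B) (prodℕ m) (λ t → prodR R m (λ i → F i (t i))) n
      ≈ Π⋆ m (λ i → pushforward (B i) (λ x → x) (F i)) n
  pushforward-tuples zero B F _ n _ = trans (+-identityʳ _) (when-≟-sym 1 n 1#)
  pushforward-tuples (suc m) B F 1≤B n 1≤n = begin
    Σℓ (concatMap (λ x → map (cons x) T) (B fzero)) h
      ≈⟨ Σℓ-concatMap (λ x → map (cons x) T) (B fzero) h ⟩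
    Σℓ (B fzero) (λ x → Σℓ (map (cons x) T) h)
      ≈⟨ Σℓ-cong (B fzero) (λ x → reflexive (Σℓ-map (cons x) T h)) ⟩
    Σℓ (B fzero) (λ x → Σℓ T (λ t → when ⌊ x ℕ.* prodℕ m t ≟ n ⌋ (F fzero x * wT t)))
      ≈⟨ sym (pushforward-⋆ (B fzero) T (λ x → x) (prodℕ m) (F fzero) wT n (1≤B fzero)
               (λ t∈ → 1≤prodℕ m _ (λ i → 1≤B (fsuc i) (∈-tuples⇒∈ m (B ∘ fsuc) t∈ i)))) ⟩
    (pushforward (B fzero) (λ x → x) (F fzero) ⋆ pushforward T (prodℕ m) wT) n
      ≈⟨ ⋆-congʳ _ n (λ k 1≤k _ → pushforward-tuples m (B ∘ fsuc) (F ∘ fsuc) (1≤B ∘ fsuc) k 1≤k) ⟩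
    Π⋆ (suc m) (λ i → pushforward (B i) (λ x → x) (F i)) n ∎
    where
    T = tuples m (B ∘ fsuc)
    wT : (Fin m → ℕ) → Carrier
    wT t = prodR R m (λ i → F (fsuc i) (t i))
    h : (Fin (suc m) → ℕ) → Carrier
    h t = when ⌊ prodℕ (suc m) t ≟ n ⌋ (prodR R (suc m) (λ i → F i (t i)))

  Π⋆-cong : ∀ m {F G : Fin m → ArithFn} n → (∀ i → AgreeUpTo n (F i) (G i)) → AgreeUpTo n (Π⋆ m F) (Π⋆ m G)
  Π⋆-cong zero n _ k _ _ = refl
  Π⋆-cong (suc m) n F≈G k 1≤k k≤n = ⋆-cong k
    (λ j 1≤j j≤k → F≈G fzero j 1≤j (ℕₚ.≤-trans j≤k k≤n))
    (λ j 1≤j j≤k → Π⋆-cong m n (F≈G ∘ fsuc) j 1≤j (ℕₚ.≤-trans j≤k k≤n))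

  Π⋆-vanishesBelow : ∀ m K (N : Fin m → ℕ) {D : Fin m → ArithFn} →
    (∀ i → VanishesBelow (suc (N i)) K (D i)) → VanishesBelow (prodℕ m (λ i → suc (N i))) K (Π⋆ m D)
  Π⋆-vanishesBelow zero K N _ n 1≤n _ n<1 = ⊥-elim (ℕₚ.<⇒≱ n<1 1≤n)
  Π⋆-vanishesBelow (suc m) K N D≈0 =
    ⋆-vanishesBelow (D≈0 fzero) (Π⋆-vanishesBelow m K (N ∘ fsuc) (D≈0 ∘ fsuc))

module MöbiusInversion {c ℓ : Level} (R : CommutativeRing c ℓ) where

  open CommutativeRing R hiding (zero)
  open import Algebra.Properties.Ring ring using (-0#≈0#; -‿involutive)
  open import Relation.Binary.Reasoning.Setoid setoid
  open FiniteSums R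
  open DirichletConvolution R
  open NatBounds
  open MöbiusRecurrence using (prime⇒1≤; coprime-prime; μ-p*-square; μ-p*-coprime)

  ν : ArithFn
  ν n = intR R (μ n)

  intR-neg : ∀ z → intR R (ℤ.- z) ≈ - intR R z
  intR-neg (ℤ.+ zero) = sym -0#≈0#
  intR-neg (ℤ.+ suc n) = refl
  intR-neg ℤ.-[1+ n ] = sym (-‿involutive _)

  ν-1 : ν 1 ≈ 1#
  ν-1 = +-identityʳ 1#

  ν-p*-square : ∀ {p a} → 1 ≤ a → Prime p → p ∣ a → ν (p ℕ.* a) ≈ 0#
  ν-p*-square 1≤a pp p∣a rewrite μ-p*-square 1≤a pp p∣a = refl

  ν-p*-coprime : ∀ {p a} → 1 ≤ a → Prime p → ¬ p ∣ a → ν (p ℕ.* a) ≈ - ν a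
  ν-p*-coprime {a = a} 1≤a pp p∤a rewrite μ-p*-coprime 1≤a pp p∤a = intR-neg (μ a)

  Σ≤-multiples : ∀ p r (h : ArithFn) → 1 ≤ p →
    Σ≤ (p ℕ.* r) (λ a → when ⌊ p ∣? a ⌋ (h a)) ≈ Σ≤ r (λ b → h (p ℕ.* b))
  Σ≤-multiples p zero h _ rewrite ℕₚ.*-zeroʳ p = refl
  Σ≤-multiples p (suc r) h 1≤p = begin
    Σ≤ (p ℕ.* suc r) F                              ≡⟨ ≡.cong (λ k → Σ≤ k F) p*[1+r] ⟩
    Σ≤ (p ℕ.* r ℕ.+ p) F                            ≈⟨ Σ≤-+-split (p ℕ.* r) p F ⟩
    Σ≤ (p ℕ.* r) F + Σ≤ p (λ j → F (p ℕ.* r ℕ.+ j)) ≈⟨ +-cong (Σ≤-multiples p r h 1≤p) last-block ⟩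
    Σ≤ r (λ b → h (p ℕ.* b)) + h (p ℕ.* suc r)      ∎
    where
    F : ArithFn
    F a = when ⌊ p ∣? a ⌋ (h a)
    p*[1+r] : p ℕ.* suc r ≡ p ℕ.* r ℕ.+ p
    p*[1+r] = ≡.trans (ℕₚ.*-suc p r) (ℕₚ.+-comm p (p ℕ.* r))
    only-p : ∀ j → 1 ≤ j → j ≤ p → p ∣ p ℕ.* r ℕ.+ j → j ≡ p
    only-p j 1≤j j≤p p∣ = ℕₚ.≤-antisym j≤p (∣⇒≤ {{ℕ.>-nonZero 1≤j}} (∣m+n∣m⇒∣n p∣ (m∣m*n r)))
    last-block : Σ≤ p (λ j → F (p ℕ.* r ℕ.+ j)) ≈ h (p ℕ.* suc r)
    last-block = begin
      Σ≤ p (λ j → F (p ℕ.* r ℕ.+ j))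
        ≈⟨ Σ≤-cong p (λ j 1≤j j≤p → when-⇔ (p ∣? p ℕ.* r ℕ.+ j) (j ≟ p) (only-p j 1≤j j≤p)
                                            (λ { ≡.refl → ∣m∣n⇒∣m+n (m∣m*n r) ∣-refl }) _) ⟩
      Σ≤ p (λ j → when ⌊ j ≟ p ⌋ (h (p ℕ.* r ℕ.+ j))) ≈⟨ Σ≤-δ p p _ 1≤p ℕₚ.≤-refl ⟩
      h (p ℕ.* r ℕ.+ p)                                ≡⟨ ≡.cong h (≡.sym p*[1+r]) ⟩
      h (p ℕ.* suc r)                                  ∎

  ∃prime∣ : ∀ n → 2 ≤ n → ∃ λ p → Prime p × p ∣ n
  ∃prime∣ 1 (s≤s ())
  ∃prime∣ n@(suc (suc _)) _ with factorise n
  ... | record { factors = [] ; isFactorisation = () }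
  ... | record { factors = p ∷ _ ; isFactorisation = n≡∏ ; factorsPrime = pp ∷ _ } =
    p , pp , ≡.subst (p ∣_) (≡.sym n≡∏) (m∣m*n _)

  divisorSum : ArithFn → ArithFn
  divisorSum F n = Σ≤ n (λ a → when ⌊ a ∣? n ⌋ (F a))

  divisorSum-ν-p* : ∀ p r → Prime p → 1 ≤ r → divisorSum ν (p ℕ.* r) ≈ 0#
  divisorSum-ν-p* p r pp 1≤r = begin
    Σ≤ (p ℕ.* r) (λ a → when ⌊ a ∣? p ℕ.* r ⌋ (ν a))
      ≈⟨ Σ≤-cong (p ℕ.* r) (λ a _ _ → split a) ⟩
    Σ≤ (p ℕ.* r) (λ a → Coprime a + when ⌊ p ∣? a ⌋ (when ⌊ a ∣? p ℕ.* r ⌋ (ν a)))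
      ≈⟨ Σ≤-+ (p ℕ.* r) Coprime _ ⟩
    Σ≤ (p ℕ.* r) Coprime + Σ≤ (p ℕ.* r) (λ a → when ⌊ p ∣? a ⌋ (when ⌊ a ∣? p ℕ.* r ⌋ (ν a)))
      ≈⟨ +-cong (Σ≤-extend Coprime r≤pr (λ a r<a _ → when-zero (not ⌊ p ∣? a ⌋)
                  (when-fails (a ∣? r) (λ a∣r → ℕₚ.<⇒≱ r<a (∣⇒≤ {{ℕ.>-nonZero 1≤r}} a∣r)) _)))
                (Σ≤-multiples p r _ (prime⇒1≤ pp)) ⟩
    Σ≤ r Coprime + Σ≤ r (λ b → when ⌊ p ℕ.* b ∣? p ℕ.* r ⌋ (ν (p ℕ.* b)))
      ≈⟨ +-congˡ (Σ≤-cong r (λ b 1≤b _ → multiple b 1≤b)) ⟩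
    Σ≤ r Coprime + Σ≤ r (λ b → - Coprime b) ≈⟨ +-congˡ (Σ≤-neg r Coprime) ⟩
    Σ≤ r Coprime - Σ≤ r Coprime              ≈⟨ -‿inverseʳ _ ⟩
    0# ∎
    where
    r≤pr : r ≤ p ℕ.* r
    r≤pr = m≤n*m r (prime⇒1≤ pp)
    Coprime : ArithFn
    Coprime a = when (not ⌊ p ∣? a ⌋) (when ⌊ a ∣? r ⌋ (ν a))
    split : ∀ a → when ⌊ a ∣? p ℕ.* r ⌋ (ν a) ≈ Coprime a + when ⌊ p ∣? a ⌋ (when ⌊ a ∣? p ℕ.* r ⌋ (ν a))
    split a with p ∣? a
    ... | yes _ = sym (+-identityˡ _)
    ... | no p∤a = trans (when-⇔ (a ∣? p ℕ.* r) (a ∣? r) (coprime-divisor (coprime-prime pp p∤a)) (∣n⇒∣m*n p) (ν a))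
                         (sym (+-identityʳ _))
    multiple : ∀ b → 1 ≤ b → when ⌊ p ℕ.* b ∣? p ℕ.* r ⌋ (ν (p ℕ.* b)) ≈ - Coprime b
    multiple b 1≤b = trans (when-⇔ (p ℕ.* b ∣? p ℕ.* r) (b ∣? r) (*-cancelˡ-∣ p {{prime⇒nonZero pp}}) (*-monoʳ-∣ p) _)
                           (by-cases (p ∣? b))
      where
      by-cases : (p∣b? : Dec (p ∣ b)) → when ⌊ b ∣? r ⌋ (ν (p ℕ.* b)) ≈ - when (not ⌊ p∣b? ⌋) (when ⌊ b ∣? r ⌋ (ν b))
      by-cases (yes p∣b) = trans (when-zero ⌊ b ∣? r ⌋ (ν-p*-square 1≤b pp p∣b)) (sym -0#≈0#)
      by-cases (no p∤b) = trans (when-cong ⌊ b ∣? r ⌋ (ν-p*-coprime 1≤b pp p∤b)) (sym (-‿when ⌊ b ∣? r ⌋ (ν b)))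

  divisorSum-ν : ∀ n → 1 ≤ n → divisorSum ν n ≈ δ n
  divisorSum-ν 1 _ = trans (+-identityˡ _) ν-1
  divisorSum-ν n@(suc (suc _)) _ with ∃prime∣ n (s≤s (s≤s z≤n))
  ... | p , pp , divides r@(suc _) n≡r*p =
    trans (reflexive (≡.cong (divisorSum ν) (≡.trans n≡r*p (ℕₚ.*-comm r p)))) (divisorSum-ν-p* p r pp (s≤s z≤n))
  ... | p , pp , divides zero ()

  Σ≤-when-*≟ : ∀ a n X → 1 ≤ a → 1 ≤ n → Σ≤ n (λ b → when ⌊ a ℕ.* b ≟ n ⌋ X) ≈ when ⌊ a ∣? n ⌋ X
  Σ≤-when-*≟ a n X 1≤a 1≤n with a ∣? n
  ... | no a∤n = Σ≤-zero n (λ b _ _ →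
    when-fails (a ℕ.* b ≟ n) (λ ab≡n → a∤n (divides b (≡.trans (≡.sym ab≡n) (ℕₚ.*-comm a b)))) X)
  ... | yes (divides zero n≡0) = ⊥-elim (ℕₚ.<⇒≢ 1≤n (≡.sym n≡0))
  ... | yes (divides q@(suc _) n≡q*a) =
    trans (Σ≤-cong n (λ b _ _ → when-⇔ (a ℕ.* b ≟ n) (b ≟ q)
                                   (λ ab≡n → ℕₚ.*-cancelˡ-≡ _ q a {{ℕ.>-nonZero 1≤a}} (≡.trans ab≡n n≡a*q))
                                   (λ { ≡.refl → ≡.sym n≡a*q }) X))
          (Σ≤-δ n q (λ _ → X) (s≤s z≤n) (≡.subst (q ≤_) (≡.sym n≡q*a) (m≤m*n q 1≤a)))
    where
    n≡a*q : n ≡ a ℕ.* q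
    n≡a*q = ≡.trans n≡q*a (ℕₚ.*-comm q a)

  𝟙[≤_] : ℕ → ArithFn
  𝟙[≤ K ] n = when ⌊ n ≤? K ⌋ 1#

  ν⋆𝟙≈δ : ∀ K n → 1 ≤ n → n ≤ K → (ν ⋆ 𝟙[≤ K ]) n ≈ δ n
  ν⋆𝟙≈δ K n 1≤n n≤K = begin
    Σ≤ n (λ a → Σ≤ n (λ b → when ⌊ a ℕ.* b ≟ n ⌋ (ν a * 𝟙[≤ K ] b)))
      ≈⟨ Σ≤-cong n (λ a _ _ → Σ≤-cong n (λ b _ b≤n → when-cong ⌊ a ℕ.* b ≟ n ⌋
           (trans (*-congˡ (when-holds (b ≤? K) (ℕₚ.≤-trans b≤n n≤K) 1#)) (*-identityʳ _)))) ⟩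
    Σ≤ n (λ a → Σ≤ n (λ b → when ⌊ a ℕ.* b ≟ n ⌋ (ν a)))
      ≈⟨ Σ≤-cong n (λ a 1≤a _ → Σ≤-when-*≟ a n (ν a) 1≤a 1≤n) ⟩
    divisorSum ν n ≈⟨ divisorSum-ν n 1≤n ⟩
    δ n ∎

  ν⋆𝟙⋆-inverse : ∀ K Z n → 1 ≤ n → n ≤ K → (ν ⋆ (𝟙[≤ K ] ⋆ Z)) n ≈ Z n
  ν⋆𝟙⋆-inverse K Z n 1≤n n≤K = begin
    (ν ⋆ (𝟙[≤ K ] ⋆ Z)) n ≈⟨ sym (⋆-assoc ν 𝟙[≤ K ] Z n) ⟩
    ((ν ⋆ 𝟙[≤ K ]) ⋆ Z) n ≈⟨ ⋆-congˡ Z n (λ m 1≤m m≤n → ν⋆𝟙≈δ K m 1≤m (ℕₚ.≤-trans m≤n n≤K)) ⟩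
    (δ ⋆ Z) n             ≈⟨ ⋆-identityˡ Z n 1≤n ⟩
    Z n                   ∎

module InclusionExclusion {c ℓ : Level} (R : CommutativeRing c ℓ) where

  open CommutativeRing R hiding (zero)
  open import Algebra.Properties.Ring ring using (-0#≈0#; -1*x≈-x; -‿anti-homo-+; -‿distribˡ-*)
  open import Relation.Binary.Reasoning.Setoid setoid
  open FiniteSums R
  open DirichletConvolution R

  Σwords-suc : ∀ d (h : (Fin (suc d) → Bool) → Carrier) →
    Σℓ (words (suc d)) h ≈ Σℓ (words d) (h ∘ cons false) + Σℓ (words d) (h ∘ cons true)
  Σwords-suc d h = begin
    Σℓ (words (suc d)) h
      ≈⟨ Σℓ-concatMap (λ x → map (cons x) (words d)) (false ∷ true ∷ []) h ⟩
    Σℓ (map (cons false) (words d)) h + (Σℓ (map (cons true) (words d)) h + 0#)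
      ≈⟨ +-cong (reflexive (Σℓ-map (cons false) (words d) h))
                (trans (+-identityʳ _) (reflexive (Σℓ-map (cons true) (words d) h))) ⟩
    Σℓ (words d) (h ∘ cons false) + Σℓ (words d) (h ∘ cons true) ∎

  ΣallFin-suc : ∀ d (h : Fin (suc d) → Carrier) → Σℓ (allFin (suc d)) h ≈ h fzero + Σℓ (allFin d) (h ∘ fsuc)
  ΣallFin-suc d h = +-congˡ (reflexive (≡.trans (≡.cong (sumR R) (map-tabulate fsuc h))
                                                (≡.sym (≡.cong (sumR R) (map-tabulate (λ i → i) (h ∘ fsuc))))))

  select : ∀ {d} → (Fin d → ArithFn) → (Fin d → Bool) → Fin d → ArithFn
  select c V i = if V i then c i else δ

  δ-sub : ∀ {d} → (Fin d → ArithFn) → Fin d → ArithFn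
  δ-sub c i m = δ m - c i m

  Π⋆-expand : ∀ d (c : Fin d → ArithFn) n → 1 ≤ n →
    Π⋆ d (δ-sub c) n ≈ Σℓ (words d) (λ V → signR R (weight d V) * Π⋆ d (select c V) n)
  Π⋆-expand zero c n _ = sym (trans (+-identityʳ _) (*-identityˡ _))
  Π⋆-expand (suc d) c n 1≤n = begin
    (δ-sub c fzero ⋆ X) n                        ≈⟨ ⋆-comm (δ-sub c fzero) X n ⟩
    (X ⋆ (λ m → δ m - c fzero m)) n              ≈⟨ ⋆-distribˡ-+ X δ (λ m → - c fzero m) n ⟩
    (X ⋆ δ) n + (X ⋆ (λ m → - c fzero m)) n
      ≈⟨ +-cong (⋆-identityʳ X n 1≤n) (trans (⋆-negʳ X (c fzero) n) (-‿cong (⋆-comm X (c fzero) n))) ⟩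
    X n - (c fzero ⋆ X) n
      ≈⟨ +-cong (Π⋆-expand d (c ∘ fsuc) n 1≤n)
                (-‿cong (⋆-congʳ (c fzero) n (λ m 1≤m _ → Π⋆-expand d (c ∘ fsuc) m 1≤m))) ⟩
    Σℓ W (λ V → s V * G V n) - (c fzero ⋆ (λ m → Σℓ W (λ V → s V * G V m))) n
      ≈⟨ +-congˡ (-‿cong (⋆-linearʳ (c fzero) W s G n)) ⟩
    Σℓ W (λ V → s V * G V n) - Σℓ W (λ V → s V * (c fzero ⋆ G V) n)
      ≈⟨ +-cong (Σℓ-cong W (λ V → *-congˡ (sym (⋆-identityˡ (G V) n 1≤n))))
                (trans (sym (Σℓ-neg W _)) (Σℓ-cong W (λ V → -‿distribˡ-* (s V) _))) ⟩
    Σℓ W (λ V → s V * (δ ⋆ G V) n) + Σℓ W (λ V → - s V * (c fzero ⋆ G V) n)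
      ≈⟨ sym (Σwords-suc d (λ V → signR R (weight (suc d) V) * Π⋆ (suc d) (select c V) n)) ⟩
    Σℓ (words (suc d)) (λ V → signR R (weight (suc d) V) * Π⋆ (suc d) (select c V) n) ∎
    where
    X = Π⋆ d (δ-sub (c ∘ fsuc))
    W = words d
    s : (Fin d → Bool) → Carrier
    s V = signR R (weight d V)
    G : (Fin d → Bool) → ArithFn
    G V = Π⋆ d (select (c ∘ fsuc) V)

  infixr 8 _⋆^_
  _⋆^_ : ArithFn → ℕ → ArithFn
  z ⋆^ k = Π⋆ k (λ _ → z)

  ⋆-interchange : ∀ F G H I n → ((F ⋆ G) ⋆ (H ⋆ I)) n ≈ ((F ⋆ H) ⋆ (G ⋆ I)) n
  ⋆-interchange F G H I n = begin
    ((F ⋆ G) ⋆ (H ⋆ I)) n ≈⟨ ⋆-assoc F G (H ⋆ I) n ⟩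
    (F ⋆ (G ⋆ (H ⋆ I))) n ≈⟨ ⋆-congʳ F n (λ m _ _ → sym (⋆-assoc G H I m)) ⟩
    (F ⋆ ((G ⋆ H) ⋆ I)) n ≈⟨ ⋆-congʳ F n (λ m _ _ → ⋆-congˡ I m (λ k _ _ → ⋆-comm G H k)) ⟩
    (F ⋆ ((H ⋆ G) ⋆ I)) n ≈⟨ ⋆-congʳ F n (λ m _ _ → ⋆-assoc H G I m) ⟩
    (F ⋆ (H ⋆ (G ⋆ I))) n ≈⟨ sym (⋆-assoc F H (G ⋆ I) n) ⟩
    ((F ⋆ H) ⋆ (G ⋆ I)) n ∎

  Π⋆-select-⋆ : ∀ d z (a : Fin d → ArithFn) (V : Fin d → Bool) n → 1 ≤ n →
    Π⋆ d (select (λ i → z ⋆ a i) V) n ≈ (z ⋆^ weight d V ⋆ Π⋆ d (select a V)) n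
  Π⋆-select-⋆ zero z a V n 1≤n = sym (⋆-identityˡ δ n 1≤n)
  Π⋆-select-⋆ (suc d) z a V n 1≤n with V fzero
  ... | false = begin
    (δ ⋆ Π⋆ d (select (λ i → z ⋆ a (fsuc i)) V′)) n ≈⟨ ⋆-identityˡ _ n 1≤n ⟩
    Π⋆ d (select (λ i → z ⋆ a (fsuc i)) V′) n       ≈⟨ Π⋆-select-⋆ d z (a ∘ fsuc) V′ n 1≤n ⟩
    (z ⋆^ weight d V′ ⋆ A) n                        ≈⟨ ⋆-congʳ _ n (λ m 1≤m _ → sym (⋆-identityˡ A m 1≤m)) ⟩
    (z ⋆^ weight d V′ ⋆ (δ ⋆ A)) n                  ∎
    where
    V′ = V ∘ fsuc
    A = Π⋆ d (select (a ∘ fsuc) V′)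
  ... | true = begin
    ((z ⋆ a fzero) ⋆ Π⋆ d (select (λ i → z ⋆ a (fsuc i)) V′)) n
      ≈⟨ ⋆-congʳ _ n (λ m 1≤m _ → Π⋆-select-⋆ d z (a ∘ fsuc) V′ m 1≤m) ⟩
    ((z ⋆ a fzero) ⋆ (z ⋆^ weight d V′ ⋆ A)) n ≈⟨ ⋆-interchange z (a fzero) _ _ n ⟩
    ((z ⋆ z ⋆^ weight d V′) ⋆ (a fzero ⋆ A)) n ∎
    where
    V′ = V ∘ fsuc
    A = Π⋆ d (select (a ∘ fsuc) V′)

  Σwords-weight0 : ∀ d (c : Fin d → ArithFn) n → 1 ≤ n →
    Σℓ (words d) (λ V → when (not ⌊ 1 ≤? weight d V ⌋) (Π⋆ d (select c V) n)) ≈ δ n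
  Σwords-weight0 zero c n _ = +-identityʳ _
  Σwords-weight0 (suc d) c n 1≤n = begin
    Σℓ (words (suc d)) (λ V → when (not ⌊ 1 ≤? weight (suc d) V ⌋) (Π⋆ (suc d) (select c V) n))
      ≈⟨ Σwords-suc d _ ⟩
    Σℓ (words d) (λ V → when (not ⌊ 1 ≤? weight d V ⌋) ((δ ⋆ G V) n))
      + Σℓ (words d) (λ V → when (not ⌊ 1 ≤? suc (weight d V) ⌋) ((c fzero ⋆ G V) n))
      ≈⟨ +-cong (Σℓ-cong (words d) (λ V → when-cong (not ⌊ 1 ≤? weight d V ⌋) (⋆-identityˡ _ n 1≤n)))
                (Σℓ-zero (words d) (λ _ → refl)) ⟩
    Σℓ (words d) (λ V → when (not ⌊ 1 ≤? weight d V ⌋) (G V n)) + 0#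
      ≈⟨ trans (+-identityʳ _) (Σwords-weight0 d (c ∘ fsuc) n 1≤n) ⟩
    δ n ∎
    where
    G : (Fin d → Bool) → ArithFn
    G V = Π⋆ d (select (c ∘ fsuc) V)

  when-weight<2-suc : ∀ w x → when (not ⌊ 2 ≤? suc w ⌋) (signR R (suc w) * x) ≈ - when (not ⌊ 1 ≤? w ⌋) x
  when-weight<2-suc zero x = -1*x≈-x x
  when-weight<2-suc (suc w) x = sym -0#≈0#

  Σwords-weight<2 : ∀ d (c : Fin d → ArithFn) n → 1 ≤ n →
    Σℓ (words d) (λ V → when (not ⌊ 2 ≤? weight d V ⌋) (signR R (weight d V) * Π⋆ d (select c V) n))
      ≈ δ n - Σℓ (allFin d) (λ i → c i n)
  Σwords-weight<2 zero c n _ = trans (+-identityʳ _) (trans (*-identityˡ _) (sym (trans (+-congˡ -0#≈0#) (+-identityʳ _))))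
  Σwords-weight<2 (suc d) c n 1≤n = begin
    Σℓ (words (suc d)) (λ V → when (not ⌊ 2 ≤? weight (suc d) V ⌋) (signR R (weight (suc d) V) * Π⋆ (suc d) (select c V) n))
      ≈⟨ Σwords-suc d _ ⟩
    Σℓ W (λ V → when (not ⌊ 2 ≤? weight d V ⌋) (signR R (weight d V) * (δ ⋆ G V) n))
      + Σℓ W (λ V → when (not ⌊ 2 ≤? suc (weight d V) ⌋) (signR R (suc (weight d V)) * (c fzero ⋆ G V) n))
      ≈⟨ +-cong (Σℓ-cong W (λ V → when-cong (not ⌊ 2 ≤? weight d V ⌋) (*-congˡ (⋆-identityˡ _ n 1≤n))))
                (trans (Σℓ-cong W (λ V → when-weight<2-suc (weight d V) _)) (Σℓ-neg W _)) ⟩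
    Σℓ W (λ V → when (not ⌊ 2 ≤? weight d V ⌋) (signR R (weight d V) * G V n))
      - Σℓ W (λ V → when (not ⌊ 1 ≤? weight d V ⌋) ((c fzero ⋆ G V) n))
      ≈⟨ +-cong (Σwords-weight<2 d (c ∘ fsuc) n 1≤n)
                (-‿cong (sym (trans (⋆-Σℓ (c fzero) W (λ V m → when (not ⌊ 1 ≤? weight d V ⌋) (G V m)) n)
                                    (Σℓ-cong W (λ V → ⋆-whenʳ (c fzero) (G V) _ n))))) ⟩
    (δ n - Σℓ (allFin d) (λ i → c (fsuc i) n))
      - (c fzero ⋆ (λ m → Σℓ W (λ V → when (not ⌊ 1 ≤? weight d V ⌋) (G V m)))) n
      ≈⟨ +-congˡ (-‿cong (trans (⋆-congʳ (c fzero) n (λ m 1≤m _ → Σwords-weight0 d (c ∘ fsuc) m 1≤m))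
                                (⋆-identityʳ (c fzero) n 1≤n))) ⟩
    (δ n - Σℓ (allFin d) (λ i → c (fsuc i) n)) - c fzero n
      ≈⟨ trans (+-assoc _ _ _) (+-congˡ (sym (-‿anti-homo-+ (c fzero n) _))) ⟩
    δ n - (c fzero n + Σℓ (allFin d) (λ i → c (fsuc i) n))
      ≈⟨ +-congˡ (-‿cong (sym (ΣallFin-suc d (λ i → c i n)))) ⟩
    δ n - Σℓ (allFin (suc d)) (λ i → c i n) ∎
    where
    W = words d
    G : (Fin d → Bool) → ArithFn
    G V = Π⋆ d (select (c ∘ fsuc) V)

module PartialSums {c ℓ : Level} (R : CommutativeRing c ℓ) where

  open CommutativeRing R hiding (zero)
  open import Algebra.Properties.Ring ring using (-‿distribʳ-*)
  open import Relation.Binary.Reasoning.Setoid setoid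
  open CommutativeSemigroupProperties *-commutativeSemigroup using () renaming (x∙yz≈y∙xz to x*[y*z]≈y*[x*z])
  open CommutativeSemigroupProperties +-commutativeSemigroup using () renaming (x∙yz≈y∙xz to x+[y+z]≈y+[x+z])
  open import Algebra.Properties.AbelianGroup +-abelianGroup using (x∙y⁻¹≈ε⇒x≈y; ⁻¹-anti-homo‿-)
  open FiniteSums R
  open DirichletConvolution R
  open MöbiusInversion R
  open InclusionExclusion R
  open NatBounds
  open Tuples

  module _ (g : ArithFn) (g-mult : TotallyMultiplicative R g) where

    -- The accumulator x makes the induction work without g 1 ≈ 1, which total multiplicativity does not give.
    g-*-prodR : ∀ m (h : ArithFn) x (t : Fin m → ℕ) → 1 ≤ x → (∀ i → 1 ≤ t i) →
      g x * prodR R m (λ i → h (t i) * g (t i)) ≈ g (x ℕ.* prodℕ m t) * prodR R m (h ∘ t)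
    g-*-prodR zero h x t _ _ = *-congʳ (reflexive (≡.cong g (≡.sym (ℕₚ.*-identityʳ x))))
    g-*-prodR (suc m) h x t 1≤x 1≤t = begin
      g x * (h t₀ * g t₀ * P)   ≈⟨ *-congˡ (trans (*-congʳ (*-comm _ _)) (*-assoc _ _ _)) ⟩
      g x * (g t₀ * (h t₀ * P)) ≈⟨ sym (*-assoc _ _ _) ⟩
      g x * g t₀ * (h t₀ * P)   ≈⟨ *-congʳ (sym (g-mult x t₀ 1≤x (1≤t fzero))) ⟩
      g (x ℕ.* t₀) * (h t₀ * P) ≈⟨ x*[y*z]≈y*[x*z] _ _ _ ⟩
      h t₀ * (g (x ℕ.* t₀) * P)
        ≈⟨ *-congˡ (g-*-prodR m h (x ℕ.* t₀) (t ∘ fsuc) (ℕₚ.*-mono-≤ 1≤x (1≤t fzero)) (1≤t ∘ fsuc)) ⟩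
      h t₀ * (g (x ℕ.* t₀ ℕ.* prodℕ m (t ∘ fsuc)) * prodR R m (h ∘ t ∘ fsuc))
        ≈⟨ x*[y*z]≈y*[x*z] _ _ _ ⟩
      g (x ℕ.* t₀ ℕ.* prodℕ m (t ∘ fsuc)) * prodR R (suc m) (h ∘ t)
        ≡⟨ ≡.cong (λ y → g y * prodR R (suc m) (h ∘ t)) (ℕₚ.*-assoc x t₀ _) ⟩
      g (x ℕ.* prodℕ (suc m) t) * prodR R (suc m) (h ∘ t) ∎
      where
      t₀ = t fzero
      P = prodR R m (λ i → h (t (fsuc i)) * g (t (fsuc i)))

    module _ (d : ℕ) (N : Fin d → ℕ) (K : ℕ) where

      νN : Fin d → ArithFn
      νN i n = when ⌊ n ≤? N i ⌋ (ν n)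

      𝟙⋆νN : Fin d → ArithFn
      𝟙⋆νN i = 𝟙[≤ K ] ⋆ νN i

      δ-sub-vanishes : ∀ i → VanishesBelow (suc (N i)) K (δ-sub 𝟙⋆νN i)
      δ-sub-vanishes i n 1≤n n≤K n≤Nᵢ = begin
        δ n - (𝟙[≤ K ] ⋆ νN i) n
          ≈⟨ +-congˡ (-‿cong (⋆-congʳ 𝟙[≤ K ] n (λ m _ m≤n →
               when-holds (m ≤? N i) (ℕₚ.≤-trans m≤n (ℕₚ.≤-pred n≤Nᵢ)) (ν m)))) ⟩
        δ n - (𝟙[≤ K ] ⋆ ν) n ≈⟨ +-congˡ (-‿cong (trans (⋆-comm 𝟙[≤ K ] ν n) (ν⋆𝟙≈δ K n 1≤n n≤K))) ⟩
        δ n - δ n             ≈⟨ -‿inverseʳ _ ⟩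
        0#                    ∎

      ν⋆Π⋆δ-sub-vanishes : VanishesBelow (prodℕ d (suc ∘ N)) K (ν ⋆ Π⋆ d (δ-sub 𝟙⋆νN))
      ν⋆Π⋆δ-sub-vanishes n 1≤n n≤K n<∏ =
        ⋆-vanishesBelow {p = 1} (λ m 1≤m _ m<1 → ⊥-elim (ℕₚ.<⇒≱ m<1 1≤m)) (Π⋆-vanishesBelow d K N δ-sub-vanishes)
          n 1≤n n≤K (≡.subst (n <_) (≡.sym (ℕₚ.*-identityˡ _)) n<∏)

      ν⋆Π⋆-select : ∀ V j → weight d V ≡ suc j → ∀ n → 1 ≤ n → n ≤ K →
        (ν ⋆ Π⋆ d (select 𝟙⋆νN V)) n ≈ (𝟙[≤ K ] ⋆^ j ⋆ Π⋆ d (select νN V)) n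
      ν⋆Π⋆-select V j w≡1+j n 1≤n n≤K = begin
        (ν ⋆ Π⋆ d (select 𝟙⋆νN V)) n         ≈⟨ ⋆-congʳ ν n (λ m 1≤m _ → Π⋆-select-⋆ d 𝟙[≤ K ] νN V m 1≤m) ⟩
        (ν ⋆ (𝟙[≤ K ] ⋆^ weight d V ⋆ A)) n  ≈⟨ sym (⋆-assoc ν _ A n) ⟩
        ((ν ⋆ 𝟙[≤ K ] ⋆^ weight d V) ⋆ A) n  ≡⟨ ≡.cong (λ k → ((ν ⋆ 𝟙[≤ K ] ⋆^ k) ⋆ A) n) w≡1+j ⟩
        ((ν ⋆ (𝟙[≤ K ] ⋆ 𝟙[≤ K ] ⋆^ j)) ⋆ A) n
          ≈⟨ ⋆-congˡ A n (λ m 1≤m m≤n → ν⋆𝟙⋆-inverse K _ m 1≤m (ℕₚ.≤-trans m≤n n≤K)) ⟩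
        (𝟙[≤ K ] ⋆^ j ⋆ A) n                 ∎
        where A = Π⋆ d (select νN V)

      box : (Fin d → Bool) → Fin d → List ℕ
      box V i = if V i then range1 (N i) else (1 ∷ [])

      ∈-box⇒1≤ : ∀ V i {x} → x ∈ box V i → 1 ≤ x
      ∈-box⇒1≤ V i x∈ with V i
      ... | true = ∈-range1⇒1≤ x∈
      ∈-box⇒1≤ V i (here ≡.refl) | false = s≤s z≤n

      pushforward-box : ∀ V i n → 1 ≤ n → pushforward (box V i) (λ x → x) ν n ≈ select νN V i n
      pushforward-box V i n 1≤n with V i
      ... | true = trans (Σℓ-range1 (N i) _) (Σ≤-δ-≤? (N i) n ν 1≤n)
      ... | false = trans (+-identityʳ _) (trans (when-≟-sym 1 n _) (when-cong ⌊ n ≟ 1 ⌋ ν-1))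

      boxTuples : (Fin d → Bool) → List (Fin d → ℕ)
      boxTuples V = tuples d (box V)

      Πν : (Fin d → ℕ) → Carrier
      Πν n = prodR R d (ν ∘ n)

      kTuples : (j : ℕ) → List (Fin j → ℕ)
      kTuples j = tuples j (λ _ → range1 K)

      wordCoefficient : (Fin d → Bool) → ArithFn
      wordCoefficient V m = Σℓ (boxTuples V) (λ n → Σℓ (kTuples (weight d V ℕ.∸ 1)) (λ k →
        when ⌊ prodℕ (weight d V ℕ.∸ 1) k ℕ.* prodℕ d n ≟ m ⌋ (Πν n)))

      wordCoefficient-⋆ : ∀ V m → 1 ≤ m →
        wordCoefficient V m ≈ (𝟙[≤ K ] ⋆^ (weight d V ℕ.∸ 1) ⋆ Π⋆ d (select νN V)) m
      wordCoefficient-⋆ V m 1≤m = begin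
        wordCoefficient V m ≈⟨ Σℓ-comm (boxTuples V) (kTuples j) _ ⟩
        Σℓ (kTuples j) (λ k → Σℓ (boxTuples V) (λ n → when ⌊ prodℕ j k ℕ.* prodℕ d n ≟ m ⌋ (Πν n)))
          ≈⟨ Σℓ-cong (kTuples j) (λ k → Σℓ-cong (boxTuples V) (λ n →
               when-cong ⌊ prodℕ j k ℕ.* prodℕ d n ≟ m ⌋ (sym (*-identityˡ _)))) ⟩
        Σℓ (kTuples j) (λ k → Σℓ (boxTuples V) (λ n → when ⌊ prodℕ j k ℕ.* prodℕ d n ≟ m ⌋ (1# * Πν n)))
          ≈⟨ sym (pushforward-⋆ (kTuples j) (boxTuples V) (prodℕ j) (prodℕ d) (λ _ → 1#) Πν m
                   (λ k∈ → 1≤prodℕ j _ (λ i → ∈-range1⇒1≤ (∈-tuples⇒∈ j _ k∈ i)))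
                   (λ n∈ → 1≤prodℕ d _ (λ i → ∈-box⇒1≤ V i (∈-tuples⇒∈ d (box V) n∈ i)))) ⟩
        (pushforward (kTuples j) (prodℕ j) (λ _ → 1#) ⋆ pushforward (boxTuples V) (prodℕ d) Πν) m
          ≈⟨ ⋆-cong m kTuples≈ box≈ ⟩
        (𝟙[≤ K ] ⋆^ j ⋆ Π⋆ d (select νN V)) m ∎
        where
        j = weight d V ℕ.∸ 1
        prodR-1# : ∀ k → prodR R k (λ _ → 1#) ≈ 1#
        prodR-1# zero = refl
        prodR-1# (suc k) = trans (*-identityˡ _) (prodR-1# k)
        kTuples≈ : AgreeUpTo m (pushforward (kTuples j) (prodℕ j) (λ _ → 1#)) (𝟙[≤ K ] ⋆^ j)
        kTuples≈ x 1≤x _ = begin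
          pushforward (kTuples j) (prodℕ j) (λ _ → 1#) x
            ≈⟨ Σℓ-cong (kTuples j) (λ k → when-cong ⌊ prodℕ j k ≟ x ⌋ (sym (prodR-1# j))) ⟩
          pushforward (kTuples j) (prodℕ j) (λ _ → prodR R j (λ _ → 1#)) x
            ≈⟨ pushforward-tuples j (λ _ → range1 K) (λ _ _ → 1#) (λ _ → ∈-range1⇒1≤) x 1≤x ⟩
          Π⋆ j (λ _ → pushforward (range1 K) (λ y → y) (λ _ → 1#)) x
            ≈⟨ Π⋆-cong j x (λ _ y 1≤y _ → trans (Σℓ-range1 K _) (Σ≤-δ-≤? K y _ 1≤y)) x 1≤x ℕₚ.≤-refl ⟩
          (𝟙[≤ K ] ⋆^ j) x ∎
        box≈ : AgreeUpTo m (pushforward (boxTuples V) (prodℕ d) Πν) (Π⋆ d (select νN V))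
        box≈ x 1≤x _ = trans (pushforward-tuples d (box V) (λ _ → ν) (∈-box⇒1≤ V) x 1≤x)
                             (Π⋆-cong d x (λ i y 1≤y _ → pushforward-box V i y 1≤y) x 1≤x ℕₚ.≤-refl)

      wordTerm-Σ≤ : ∀ V → wordTerm R g d N K V ≈ Σ≤ K (λ m → g m * wordCoefficient V m)
      wordTerm-Σ≤ V = begin
        Σℓ T (λ n → innerSum R g j K (prodℕ d n) * prodR R d (λ i → ν (n i) * g (n i)))
          ≈⟨ Σℓ-cong-∈ T (λ n∈ → trans (Σℓ-*ʳ (kTuples j) _ _) (Σℓ-cong-∈ (kTuples j) (λ k∈ →
               term _ _ (λ i → ∈-range1⇒1≤ (∈-tuples⇒∈ j _ k∈ i)) (λ i → ∈-box⇒1≤ V i (∈-tuples⇒∈ d (box V) n∈ i))))) ⟩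
        Σℓ T (λ n → Σℓ (kTuples j) (λ k → Σ≤ K (λ m → g m * when ⌊ prodℕ j k ℕ.* prodℕ d n ≟ m ⌋ (Πν n))))
          ≈⟨ trans (Σℓ-cong T (λ n → sym (Σ≤-Σℓ K (kTuples j) _))) (sym (Σ≤-Σℓ K T _)) ⟩
        Σ≤ K (λ m → Σℓ T (λ n → Σℓ (kTuples j) (λ k → g m * when ⌊ prodℕ j k ℕ.* prodℕ d n ≟ m ⌋ (Πν n))))
          ≈⟨ Σ≤-cong K (λ m _ _ → trans (Σℓ-cong T (λ n → sym (Σℓ-*ˡ (kTuples j) (g m) _))) (sym (Σℓ-*ˡ T (g m) _))) ⟩
        Σ≤ K (λ m → g m * wordCoefficient V m) ∎
        where
        j = weight d V ℕ.∸ 1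
        T = boxTuples V
        term : ∀ k n → (∀ i → 1 ≤ k i) → (∀ i → 1 ≤ n i) →
          when ⌊ prodℕ j k ℕ.* prodℕ d n ≤? K ⌋ (g (prodℕ j k)) * prodR R d (λ i → ν (n i) * g (n i))
            ≈ Σ≤ K (λ m → g m * when ⌊ prodℕ j k ℕ.* prodℕ d n ≟ m ⌋ (Πν n))
        term k n 1≤k 1≤n = begin
          when ⌊ x ≤? K ⌋ (g (prodℕ j k)) * prodR R d (λ i → ν (n i) * g (n i))
            ≈⟨ when-*ʳ ⌊ x ≤? K ⌋ _ _ ⟩
          when ⌊ x ≤? K ⌋ (g (prodℕ j k) * prodR R d (λ i → ν (n i) * g (n i)))
            ≈⟨ when-cong ⌊ x ≤? K ⌋ (g-*-prodR d ν (prodℕ j k) n (1≤prodℕ j k 1≤k) 1≤n) ⟩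
          when ⌊ x ≤? K ⌋ (g x * Πν n)
            ≈⟨ sym (Σ≤-δ-≤? K x (λ m → g m * Πν n) (ℕₚ.*-mono-≤ (1≤prodℕ j k 1≤k) (1≤prodℕ d n 1≤n))) ⟩
          Σ≤ K (λ m → when ⌊ m ≟ x ⌋ (g m * Πν n))
            ≈⟨ Σ≤-cong K (λ m _ _ → trans (when-≟-sym m x _) (sym (when-*ˡ ⌊ x ≟ m ⌋ (g m) _))) ⟩
          Σ≤ K (λ m → g m * when ⌊ x ≟ m ⌋ (Πν n)) ∎
          where x = prodℕ j k ℕ.* prodℕ d n

      signedTerm : (Fin d → Bool) → ArithFn
      signedTerm V m = signR R (weight d V) * (ν ⋆ Π⋆ d (select 𝟙⋆νN V)) m

      Σwords-signedTerm : ∀ m → 1 ≤ m → m ≤ K → m < prodℕ d (suc ∘ N) →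
        Σℓ (words d) (λ V → signedTerm V m) ≈ 0#
      Σwords-signedTerm m 1≤m m≤K m<∏ = begin
        Σℓ (words d) (λ V → signedTerm V m)
          ≈⟨ sym (⋆-linearʳ ν (words d) (signR R ∘ weight d) (λ V → Π⋆ d (select 𝟙⋆νN V)) m) ⟩
        (ν ⋆ (λ k → Σℓ (words d) (λ V → signR R (weight d V) * Π⋆ d (select 𝟙⋆νN V) k))) m
          ≈⟨ ⋆-congʳ ν m (λ k 1≤k _ → sym (Π⋆-expand d 𝟙⋆νN k 1≤k)) ⟩
        (ν ⋆ Π⋆ d (δ-sub 𝟙⋆νN)) m ≈⟨ ν⋆Π⋆δ-sub-vanishes m 1≤m m≤K m<∏ ⟩
        0# ∎

      Σtruncated : ArithFn
      Σtruncated m = Σℓ (allFin d) (λ i → νN i m)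

      Σlight-signedTerm : ∀ m → 1 ≤ m → m ≤ K →
        Σℓ (words d) (λ V → when (not ⌊ 2 ≤? weight d V ⌋) (signedTerm V m)) ≈ ν m - Σtruncated m
      Σlight-signedTerm m 1≤m m≤K = begin
        Σℓ (words d) (λ V → when (light V) (signedTerm V m))
          ≈⟨ Σℓ-cong (words d) (λ V →
               trans (when-cong (light V) (sym (⋆-scaleʳ ν _ _ m))) (sym (⋆-whenʳ ν _ (light V) m))) ⟩
        Σℓ (words d) (λ V → (ν ⋆ (λ k → when (light V) (signR R (weight d V) * Π⋆ d (select 𝟙⋆νN V) k))) m)
          ≈⟨ sym (⋆-Σℓ ν (words d) _ m) ⟩
        (ν ⋆ (λ k → Σℓ (words d) (λ V → when (light V) (signR R (weight d V) * Π⋆ d (select 𝟙⋆νN V) k)))) m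
          ≈⟨ ⋆-congʳ ν m (λ k 1≤k _ → Σwords-weight<2 d 𝟙⋆νN k 1≤k) ⟩
        (ν ⋆ (λ k → δ k - Σℓ (allFin d) (λ i → 𝟙⋆νN i k))) m
          ≈⟨ ⋆-distribˡ-+ ν δ _ m ⟩
        (ν ⋆ δ) m + (ν ⋆ (λ k → - Σℓ (allFin d) (λ i → 𝟙⋆νN i k))) m
          ≈⟨ +-cong (⋆-identityʳ ν m 1≤m) (trans (⋆-negʳ ν _ m) (-‿cong (⋆-Σℓ ν (allFin d) 𝟙⋆νN m))) ⟩
        ν m - Σℓ (allFin d) (λ i → (ν ⋆ 𝟙⋆νN i) m)
          ≈⟨ +-congˡ (-‿cong (Σℓ-cong (allFin d) (λ i → ν⋆𝟙⋆-inverse K (νN i) m 1≤m m≤K))) ⟩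
        ν m - Σtruncated m ∎
        where
        light : (Fin d → Bool) → Bool
        light V = not ⌊ 2 ≤? weight d V ⌋

      heavyWords : List (Fin d → Bool)
      heavyWords = filter (λ V → 2 ≤? weight d V) (words d)

      heavyCoefficient : ArithFn
      heavyCoefficient m = Σℓ heavyWords (λ V → signR R (weight d V) * wordCoefficient V m)

      Σheavy-signedTerm : ∀ m → 1 ≤ m → m ≤ K → Σℓ heavyWords (λ V → signedTerm V m) ≈ heavyCoefficient m
      Σheavy-signedTerm m 1≤m m≤K = Σℓ-cong-∈ heavyWords (λ V∈ →
        *-congˡ (heavy (proj₂ (∈-filter⁻ (λ V → 2 ≤? weight d V) {xs = words d} V∈))))
        where
        heavy : ∀ {V} → 2 ≤ weight d V → (ν ⋆ Π⋆ d (select 𝟙⋆νN V)) m ≈ wordCoefficient V m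
        heavy {V} 2≤w = trans (ν⋆Π⋆-select V _ (≡.sym (ℕₚ.m+[n∸m]≡n (ℕₚ.≤-trans (s≤s z≤n) 2≤w))) m 1≤m m≤K)
                              (sym (wordCoefficient-⋆ V m 1≤m))

      ν-decomposition : ∀ m → 1 ≤ m → m ≤ K → m < prodℕ d (suc ∘ N) → ν m ≈ Σtruncated m - heavyCoefficient m
      ν-decomposition m 1≤m m≤K m<∏ = x∙y⁻¹≈ε⇒x≈y (ν m) (A - H) (begin
        ν m - (A - H)  ≈⟨ +-congˡ (⁻¹-anti-homo‿- A H) ⟩
        ν m + (H - A)  ≈⟨ x+[y+z]≈y+[x+z] (ν m) H (- A) ⟩
        H + (ν m - A)  ≈⟨ +-cong (sym (Σheavy-signedTerm m 1≤m m≤K)) (sym (Σlight-signedTerm m 1≤m m≤K)) ⟩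
        Σℓ heavyWords (λ V → signedTerm V m) + Σℓ (words d) (λ V → when (not ⌊ 2 ≤? weight d V ⌋) (signedTerm V m))
          ≈⟨ sym (Σℓ-filter-split (λ V → 2 ≤? weight d V) (words d) (λ V → signedTerm V m)) ⟩
        Σℓ (words d) (λ V → signedTerm V m) ≈⟨ Σwords-signedTerm m 1≤m m≤K m<∏ ⟩
        0# ∎)
        where
        A = Σtruncated m
        H = heavyCoefficient m

      M-⊓ : ∀ i → M R g (N i ⊓ K) ≈ Σ≤ K (λ m → g m * νN i m)
      M-⊓ i = begin
        M R g (N i ⊓ K) ≈⟨ Σℓ-range1 (N i ⊓ K) _ ⟩
        Σ≤ (N i ⊓ K) (λ m → ν m * g m)
          ≈⟨ Σ≤-cong (N i ⊓ K) (λ m _ m≤ → trans (*-comm _ _)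
               (*-congˡ (sym (when-holds (m ≤? N i) (ℕₚ.≤-trans m≤ (ℕₚ.m⊓n≤m (N i) K)) (ν m))))) ⟩
        Σ≤ (N i ⊓ K) (λ m → g m * νN i m)
          ≈⟨ sym (Σ≤-extend _ (ℕₚ.m⊓n≤n (N i) K) (λ m ⊓<m m≤K →
               trans (*-congˡ (when-fails (m ≤? N i) (λ m≤Nᵢ → ℕₚ.<⇒≱ ⊓<m (ℕₚ.⊓-glb m≤Nᵢ m≤K)) (ν m))) (zeroʳ _))) ⟩
        Σ≤ K (λ m → g m * νN i m) ∎

      firstSum-Σ≤ : firstSum R g d N K ≈ Σ≤ K (λ m → g m * Σtruncated m)
      firstSum-Σ≤ = begin
        Σℓ (allFin d) (λ i → M R g (N i ⊓ K))                   ≈⟨ Σℓ-cong (allFin d) M-⊓ ⟩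
        Σℓ (allFin d) (λ i → Σ≤ K (λ m → g m * νN i m))        ≈⟨ sym (Σ≤-Σℓ K (allFin d) _) ⟩
        Σ≤ K (λ m → Σℓ (allFin d) (λ i → g m * νN i m))        ≈⟨ Σ≤-cong K (λ m _ _ → sym (Σℓ-*ˡ (allFin d) (g m) _)) ⟩
        Σ≤ K (λ m → g m * Σtruncated m)                         ∎

      bigSum-Σ≤ : bigSum R g d N K ≈ Σ≤ K (λ m → g m * heavyCoefficient m)
      bigSum-Σ≤ = begin
        Σℓ heavyWords (λ V → signR R (weight d V) * wordTerm R g d N K V)
          ≈⟨ Σℓ-cong heavyWords (λ V → trans (*-congˡ (wordTerm-Σ≤ V)) (Σ≤-*ˡ K _ _)) ⟩
        Σℓ heavyWords (λ V → Σ≤ K (λ m → signR R (weight d V) * (g m * wordCoefficient V m)))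
          ≈⟨ sym (Σ≤-Σℓ K heavyWords _) ⟩
        Σ≤ K (λ m → Σℓ heavyWords (λ V → signR R (weight d V) * (g m * wordCoefficient V m)))
          ≈⟨ Σ≤-cong K (λ m _ _ →
               trans (Σℓ-cong heavyWords (λ V → x*[y*z]≈y*[x*z] _ _ _)) (sym (Σℓ-*ˡ heavyWords (g m) _))) ⟩
        Σ≤ K (λ m → g m * heavyCoefficient m) ∎

      M≈firstSum-bigSum : K < prodℕ d (suc ∘ N) → M R g K ≈ firstSum R g d N K - bigSum R g d N K
      M≈firstSum-bigSum K<∏ = begin
        M R g K ≈⟨ Σℓ-range1 K _ ⟩
        Σ≤ K (λ m → ν m * g m)
          ≈⟨ Σ≤-cong K (λ m 1≤m m≤K →
               trans (*-comm _ _) (*-congˡ (ν-decomposition m 1≤m m≤K (ℕₚ.≤-<-trans m≤K K<∏)))) ⟩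
        Σ≤ K (λ m → g m * (Σtruncated m - heavyCoefficient m))
          ≈⟨ Σ≤-cong K (λ m _ _ → trans (distribˡ (g m) _ _) (+-congˡ (sym (-‿distribʳ-* (g m) _)))) ⟩
        Σ≤ K (λ m → g m * Σtruncated m - g m * heavyCoefficient m)
          ≈⟨ trans (Σ≤-+ K _ _) (+-congˡ (Σ≤-neg K _)) ⟩
        Σ≤ K (λ m → g m * Σtruncated m) - Σ≤ K (λ m → g m * heavyCoefficient m)
          ≈⟨ +-cong (sym firstSum-Σ≤) (-‿cong (sym bigSum-Σ≤)) ⟩
        firstSum R g d N K - bigSum R g d N K ∎

theorem1 : ∀ {c ℓ : Level} (R : CommutativeRing c ℓ) →
    let open CommutativeRing R in
    (g : ℕ → Carrier) → TotallyMultiplicative R g →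
    (d : ℕ) → 2 ≤ d →
    (N : Fin d → ℕ) → (∀ i → 1 ≤ N i) →
    (K : ℕ) → 1 ≤ K → K < prodℕ d (λ i → suc (N i)) →
    M R g K ≈ firstSum R g d N K - bigSum R g d N K
theorem1 R g g-mult d _ N _ K _ = PartialSums.M≈firstSum-bigSum R g g-mult d N K
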